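{- Let $G$ be a homocyclic group of exponent $\exp(G)\in\{2,3,4\}$ (that is, $G\cong C_m^n$ with $m\in\{2,3,4\}$ and $n\ge 1$), and let $n:=\operatorname{rk} G$. If $A\subseteq G$ is non-empty and $\partial_S(A)\le(1-\gamma)n|A|$ for some generating subset $S\subseteq G$ and some real $\gamma\in(0,1]$, then $$|A|\ge |G|^{\gamma}.$$
   Context: For finite subsets $A,S$ of an abelian group $G$, $\partial_S(A)$ denotes the number of edges from $A$ to its complement in the directed Cayley graph induced on $G$ by $S$, i.e. $\partial_S(A)=|\{(a,s)\in A\times S: a+s\notin A\}|$. $C_m$ denotes the cyclic group of order $m$.
   Formalization: The parameter γ ranges over the rationals in (0,1] rather than the reals. -}

module Defs where

open import Data.Nat using (ℕ; zero; suc; _+_; NonZero)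
open import Data.Nat.DivMod using (_mod_)
open import Data.Fin using (Fin; toℕ)
open import Data.Fin.Properties using () renaming (_≟_ to _≟F_)
open import Data.Vec using (Vec; zipWith; replicate)
open import Data.Vec.Properties using (≡-dec)
open import Data.List using (List; map)
open import Data.Nat.ListAction using (sum)
import Data.List.Membership.DecPropositional as DecMem
open import Data.List.Membership.Propositional using (_∈_)
open import Relation.Nullary using (yes; no)
open import Relation.Binary.PropositionalEquality using (_≡_)

-- The homocyclic group C_m^n, modelled concretely as vectors of residues mod m.
Grp : (m n : ℕ) → Set
Grp m n = Vec (Fin m) n

_+ₘ_ : {m : ℕ} .{{_ : NonZero m}} → Fin m → Fin m → Fin m
_+ₘ_ {m} a b = (toℕ a + toℕ b) mod m

zeroₘ : {m : ℕ} .{{_ : NonZero m}} → Fin m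
zeroₘ {m} = 0 mod m

_⊕_ : {m n : ℕ} .{{_ : NonZero m}} → Grp m n → Grp m n → Grp m n
x ⊕ y = zipWith _+ₘ_ x y

𝟎 : {m n : ℕ} .{{_ : NonZero m}} → Grp m n
𝟎 {n = n} = replicate n zeroₘ

-- subgroup generated by S (finite group: closure under 0 and + suffices)
data Generated {m n : ℕ} .{{_ : NonZero m}} (S : List (Grp m n)) : Grp m n → Set where
  gen-zero : Generated S 𝟎
  gen-elem : ∀ {s} → s ∈ S → Generated S s
  gen-add  : ∀ {x y} → Generated S x → Generated S y → Generated S (x ⊕ y)

Generates : {m n : ℕ} .{{_ : NonZero m}} → List (Grp m n) → Set
Generates {m} {n} S = (g : Grp m n) → Generated S g

boundary : {m n : ℕ} .{{_ : NonZero m}} → List (Grp m n) → List (Grp m n) → ℕ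
boundary {m} {n} S A = sum (map (λ a → sum (map (λ s → indicator (a ⊕ s)) S)) A)
  where
  open DecMem (≡-dec {n = n} _≟F_) using (_∈?_)
  indicator : Grp m n → ℕ
  indicator x with x ∈? A
  ... | yes _ = 0
  ... | no _ = 1

-- Write S = s₁ ∷ … ∷ sₖ and let rᵢ ≤ exp G be the order of sᵢ modulo ⟨sᵢ₊₁, …, sₖ⟩, so that
-- |G| ≤ N := r₁ ⋯ rₖ.  By induction on k, every finite A satisfies
--   N ^ |A| ≤ |A| ^ |A| · exp(G) ^ ∂_S(A).
-- The bound survives disjoint unions (aᵃ bᵇ ≤ (a + b)ᵃ⁺ᵇ), so A may be taken inside one coset
-- of ⟨S⟩.  There the cosets of ⟨s₂, …, sₖ⟩ form a cycle of length r = r₁ under x ↦ x + s₁; the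
-- pieces A₀, …, A_{r−1} of A satisfy the bound for s₂ ∷ … ∷ sₖ, and at least |Aᵢ| − |Aᵢ₊₁| of
-- the s₁-edges from Aᵢ leave A.  For r ≤ 4, log-convexity of x ↦ xˣ gives
--   r ^ Σ pᵢ · Π pᵢ ^ pᵢ ≤ (Σ pᵢ) ^ (Σ pᵢ) · r ^ Σ (pᵢ − pᵢ₊₁)⁺,
-- which glues the pieces together.  Finally, with exp G = m, |G| = mⁿ and ∂_S(A) ≤ (1 − γ) n |A|
-- for γ = p / q, the bound |G| ^ |A| ≤ |A| ^ |A| · m ^ ∂_S(A) turns into |A| ≥ |G| ^ γ.

module Submission where

open import Defs
open import Data.Nat using (ℕ; suc; _*_; _∸_; _^_; _≤_; _<_; NonZero)
open import Data.Sum using (_⊎_)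
open import Data.List using (List; length; _∷_)
open import Data.List.Relation.Unary.Unique.Propositional using (Unique)
open import Relation.Binary.PropositionalEquality using (_≡_)

open import Algebra.Bundles using (CommutativeMonoid; Group)
open import Algebra.Core using (Op₂)
open import Algebra.Structures using (IsCommutativeMonoid)
open import Algebra.Structures.Biased using (isCommutativeMonoidˡ)
open import Data.Bool using (true; false; if_then_else_)
open import Data.Empty using (⊥; ⊥-elim)
open import Data.Fin using (Fin; toℕ)
open import Data.Fin.Properties using (toℕ-fromℕ<; toℕ-injective; toℕ<n) renaming (_≟_ to _≟F_)
open import Data.List using ([]; [_]; map; filter; _++_; cartesianProductWith; allFin)
open import Data.List.Properties using (length-++; length-map; length-tabulate; map-cong; map-cong-local)
open import Data.List.Membership.Propositional using (_∈_)
open import Data.List.Membership.Propositional.Properties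
  using (∈-∃++; ∈-++⁻; ∈-++⁺ˡ; ∈-++⁺ʳ; ∈-filter⁺; ∈-filter⁻; ∈-map⁺; ∈-map⁻; ∈-length)
import Data.List.Membership.DecPropositional as DecMembership
open import Data.List.Relation.Unary.All using ([]; tabulate)
open import Data.List.Relation.Unary.All.Properties using (All¬⇒¬Any)
open import Data.List.Relation.Unary.AllPairs using ([]; _∷_)
open import Data.List.Relation.Unary.Any using (here; there)
import Data.List.Relation.Unary.Unique.Propositional.Properties as Unique
open import Data.Nat
open import Data.Nat.DivMod using (%-distribˡ-+; m%n%n≡m%n; m≡m%n+[m/n]*n; m%n<n; n%n≡0; m<n⇒m%n≡m; m*n%n≡0)
open import Data.Nat.ListAction using (sum)
open import Data.Nat.Properties
open import Data.Nat.Tactic.RingSolver using (solve-∀)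
open import Data.Product using (∃; ∃₂; _×_; _,_; proj₁; proj₂; uncurry)
open import Data.Sum using (inj₁; inj₂)
open import Data.Vec using ([]; _∷_)
open import Data.Vec.Properties using (≡-dec; ∷-injective; zipWith-assoc; zipWith-comm; zipWith-identityˡ)
open import Function using (_∘_)
open import Level using (0ℓ)
open import Relation.Binary.Definitions using (DecidableEquality)
open import Relation.Binary.PropositionalEquality hiding ([_])
open import Relation.Nullary using (¬_; Dec; yes; no; does; contradiction)
open import Relation.Unary using (Pred; Decidable)
open import Algebra.Properties.CommutativeSemigroup +-commutativeSemigroup
  using () renaming (interchange to +-interchange)
open import Algebra.Properties.CommutativeSemigroup *-commutativeSemigroup
  using () renaming (interchange to *-interchange)

infixl 10 _ˣ

_ˣ : ℕ → ℕ
x ˣ = x ^ x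

ˣ-nonZero : ∀ x → NonZero (x ˣ)
ˣ-nonZero zero = _
ˣ-nonZero (suc x) = m^n≢0 (suc x) (suc x)

^-distribʳ-* : ∀ m n o → (m * n) ^ o ≡ m ^ o * n ^ o
^-distribʳ-* m n zero = refl
^-distribʳ-* m n (suc o) = begin
  m * n * (m * n) ^ o     ≡⟨ cong (m * n *_) (^-distribʳ-* m n o) ⟩
  m * n * (m ^ o * n ^ o) ≡⟨ rearrange m n (m ^ o) (n ^ o) ⟩
  m * m ^ o * (n * n ^ o) ∎
  where
  open ≡-Reasoning
  rearrange : ∀ m n a b → m * n * (a * b) ≡ m * a * (n * b)
  rearrange = solve-∀

bernoulli : ∀ c j → suc c ^ suc j ≤ suc c * c ^ j + j * suc c ^ j
bernoulli c zero = ≤-reflexive (sym (+-identityʳ (suc c * 1)))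
bernoulli c (suc j) = begin
  suc c * suc c ^ suc j
    ≤⟨ *-monoʳ-≤ (suc c) (bernoulli c j) ⟩
  suc c * (suc c * c ^ j + j * suc c ^ j)
    ≡⟨ expand c (c ^ j) j (suc c ^ j) ⟩
  suc c * (c * c ^ j) + (suc c * c ^ j + j * (suc c * suc c ^ j))
    ≤⟨ +-monoʳ-≤ (suc c * (c * c ^ j)) (+-monoˡ-≤ _ c^j≤) ⟩
  suc c * (c * c ^ j) + (suc c * suc c ^ j + j * (suc c * suc c ^ j))
    ≡⟨ collect (suc c * (c * c ^ j)) (suc c * suc c ^ j) j ⟩
  suc c * (c * c ^ j) + suc j * (suc c * suc c ^ j) ∎
  where
  open ≤-Reasoning
  c^j≤ : suc c * c ^ j ≤ suc c * suc c ^ j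
  c^j≤ = *-monoʳ-≤ (suc c) (^-monoˡ-≤ j (n≤1+n c))
  expand : ∀ c a j b → suc c * (suc c * a + j * b) ≡ suc c * (c * a) + (suc c * a + j * (suc c * b))
  expand = solve-∀
  collect : ∀ x y j → x + (y + j * y) ≡ x + suc j * y
  collect = solve-∀

-- Bernoulli at c = x (x + 2) = (x + 1)² ∸ 1 and exponent x + 1, then cancel x.
ˣ-logConvex : ∀ x → suc x ˣ * suc x ˣ ≤ x ˣ * suc (suc x) ˣ
ˣ-logConvex zero = s≤s z≤n
ˣ-logConvex x@(suc _) = *-cancelˡ-≤ x (≤-trans x*T≤k*C k*C≤)
  where
  open ≤-Reasoning
  k c T C : ℕ
  k = suc x
  c = x * suc k
  T = k ˣ * k ˣ
  C = c ^ k
  1+c≡k*k : suc c ≡ k * k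
  1+c≡k*k = square x
    where
    square : ∀ x → suc (x * suc (suc x)) ≡ suc x * suc x
    square = solve-∀
  [1+c]^k≡T : suc c ^ k ≡ T
  [1+c]^k≡T = trans (cong (_^ k) 1+c≡k*k) (^-distribʳ-* k k k)
  k*k*T≤ : k * (k * T) ≤ k * (k * C + T)
  k*k*T≤ = begin
    k * (k * T)                ≡⟨ rearrange k T ⟩
    k * k * T                  ≡⟨ cong₂ _*_ (sym 1+c≡k*k) (sym [1+c]^k≡T) ⟩
    suc c ^ suc k              ≤⟨ bernoulli c k ⟩
    suc c * C + k * suc c ^ k  ≡⟨ cong₂ (λ u v → u * C + k * v) 1+c≡k*k [1+c]^k≡T ⟩
    k * k * C + k * T          ≡⟨ rearrange′ k C T ⟩
    k * (k * C + T)            ∎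
    where
    rearrange : ∀ k T → k * (k * T) ≡ k * k * T
    rearrange = solve-∀
    rearrange′ : ∀ k C T → k * k * C + k * T ≡ k * (k * C + T)
    rearrange′ = solve-∀
  x*T≤k*C : x * T ≤ k * C
  x*T≤k*C = +-cancelˡ-≤ T (x * T) (k * C)
    (≤-trans (*-cancelˡ-≤ k k*k*T≤) (≤-reflexive (+-comm (k * C) T)))
  k*C≤ : k * C ≤ x * (x ˣ * suc k ˣ)
  k*C≤ = begin
    k * C                          ≤⟨ *-monoˡ-≤ C (n≤1+n k) ⟩
    suc k * C                      ≡⟨ cong (suc k *_) (^-distribʳ-* x (suc k) k) ⟩
    suc k * (x * x ˣ * suc k ^ k)  ≡⟨ rearrange (suc k) x (x ˣ) (suc k ^ k) ⟩
    x * (x ˣ * suc k ˣ)            ∎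
    where
    rearrange : ∀ a x p b → a * (x * p * b) ≡ x * (p * (a * b))
    rearrange = solve-∀

-- Cross-multiplied: (t + 1)ˣ / tˣ, and more generally (t + w)ˣ / tˣ, is non-decreasing in t.
ˣ-ratio-mono : ∀ t d → suc t ˣ * (d + t) ˣ ≤ suc (d + t) ˣ * t ˣ
ˣ-ratio-mono t zero = ≤-refl
ˣ-ratio-mono t (suc d) = *-cancelˡ-≤ (u ˣ) {{ˣ-nonZero u}} (begin
  u ˣ * (suc t ˣ * suc u ˣ)      ≡⟨ rearrange (u ˣ) (suc t ˣ) (suc u ˣ) ⟩
  suc t ˣ * u ˣ * suc u ˣ        ≤⟨ *-monoˡ-≤ (suc u ˣ) (ˣ-ratio-mono t d) ⟩
  suc u ˣ * t ˣ * suc u ˣ        ≡⟨ rearrange′ (suc u ˣ) (t ˣ) ⟩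
  suc u ˣ * suc u ˣ * t ˣ        ≤⟨ *-monoˡ-≤ (t ˣ) (ˣ-logConvex u) ⟩
  u ˣ * suc (suc u) ˣ * t ˣ      ≡⟨ *-assoc (u ˣ) _ _ ⟩
  u ˣ * (suc (suc u) ˣ * t ˣ)    ∎)
  where
  open ≤-Reasoning
  u : ℕ
  u = d + t
  rearrange : ∀ a b c → a * (b * c) ≡ b * a * c
  rearrange = solve-∀
  rearrange′ : ∀ a b → a * b * a ≡ a * a * b
  rearrange′ = solve-∀

ˣ-gap-mono : ∀ w t d → (w + t) ˣ * (d + t) ˣ ≤ (w + (d + t)) ˣ * t ˣ
ˣ-gap-mono zero t d = ≤-reflexive (*-comm (t ˣ) ((d + t) ˣ))
ˣ-gap-mono (suc w) t d = *-cancelˡ-≤ (v ˣ * u ˣ) {{m*n≢0 _ _ {{ˣ-nonZero v}} {{ˣ-nonZero u}}}} (begin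
  v ˣ * u ˣ * (suc v ˣ * (d + t) ˣ)  ≡⟨ rearrange (v ˣ) (u ˣ) (suc v ˣ) ((d + t) ˣ) ⟩
  v ˣ * (d + t) ˣ * (suc v ˣ * u ˣ)  ≤⟨ *-mono-≤ (ˣ-gap-mono w t d) ratio ⟩
  u ˣ * t ˣ * (suc u ˣ * v ˣ)        ≡⟨ rearrange′ (u ˣ) (t ˣ) (suc u ˣ) (v ˣ) ⟩
  v ˣ * u ˣ * (suc u ˣ * t ˣ)        ∎)
  where
  open ≤-Reasoning
  v u : ℕ
  v = w + t
  u = w + (d + t)
  ratio : suc v ˣ * u ˣ ≤ suc u ˣ * v ˣ
  ratio = subst (λ z → suc v ˣ * z ˣ ≤ suc z ˣ * v ˣ) (+-comm-middle d w t) (ˣ-ratio-mono v d)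
    where
    +-comm-middle : ∀ d w t → d + (w + t) ≡ w + (d + t)
    +-comm-middle = solve-∀
  rearrange : ∀ a b c d → a * b * (c * d) ≡ a * d * (c * b)
  rearrange = solve-∀
  rearrange′ : ∀ a b c d → a * b * (c * d) ≡ d * a * (c * b)
  rearrange′ = solve-∀

ˣ-lift : ∀ w C x d → C * x ˣ ≤ (w + x) ˣ → C * (d + x) ˣ ≤ (w + (d + x)) ˣ
ˣ-lift w C x d C*xˣ≤ = *-cancelˡ-≤ (x ˣ) {{ˣ-nonZero x}} (begin
  x ˣ * (C * (d + x) ˣ)  ≡⟨ rearrange (x ˣ) C ((d + x) ˣ) ⟩
  C * x ˣ * (d + x) ˣ    ≤⟨ *-monoˡ-≤ ((d + x) ˣ) C*xˣ≤ ⟩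
  (w + x) ˣ * (d + x) ˣ  ≤⟨ ˣ-gap-mono w x d ⟩
  (w + (d + x)) ˣ * x ˣ  ≡⟨ *-comm _ (x ˣ) ⟩
  x ˣ * (w + (d + x)) ˣ  ∎)
  where
  open ≤-Reasoning
  rearrange : ∀ a b c → a * (b * c) ≡ b * a * c
  rearrange = solve-∀

ˣ-double : ∀ y → (y + y) ˣ ≡ 2 ^ (y + y) * (y ˣ * y ˣ)
ˣ-double y = begin
  (y + y) ^ (y + y)          ≡⟨ cong (_^ (y + y)) (cong (y +_) (sym (+-identityʳ y))) ⟩
  (2 * y) ^ (y + y)          ≡⟨ ^-distribʳ-* 2 y (y + y) ⟩
  2 ^ (y + y) * y ^ (y + y)  ≡⟨ cong (2 ^ (y + y) *_) (^-distribˡ-+-* y y y) ⟩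
  2 ^ (y + y) * (y ˣ * y ˣ)  ∎
  where open ≡-Reasoning

ˣ-triple : ∀ y → (y + y + y) ˣ ≡ 3 ^ (y + y + y) * (y ˣ * y ˣ * y ˣ)
ˣ-triple y = begin
  (y + y + y) ^ (y + y + y)          ≡⟨ cong (_^ (y + y + y)) (thrice y) ⟩
  (3 * y) ^ (y + y + y)              ≡⟨ ^-distribʳ-* 3 y (y + y + y) ⟩
  3 ^ (y + y + y) * y ^ (y + y + y)  ≡⟨ cong (3 ^ (y + y + y) *_) y^[y+y+y] ⟩
  3 ^ (y + y + y) * (y ˣ * y ˣ * y ˣ) ∎
  where
  open ≡-Reasoning
  thrice : ∀ y → y + y + y ≡ 3 * y
  thrice = solve-∀
  y^[y+y+y] : y ^ (y + y + y) ≡ y ˣ * y ˣ * y ˣ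
  y^[y+y+y] = trans (^-distribˡ-+-* y (y + y) y) (cong (_* y ˣ) (^-distribˡ-+-* y y y))

PairBound : ℕ → ℕ → Set
PairBound a b = 2 ^ (a + b) * (a ˣ * b ˣ) ≤ (a + b) ˣ * 2 ^ ((a ∸ b) + (b ∸ a))

ˣ-pair-sorted : ∀ d y → 2 ^ (d + y + y) * ((d + y) ˣ * y ˣ) ≤ (d + y + y) ˣ * 2 ^ d
ˣ-pair-sorted d y = begin
  2 ^ (d + y + y) * ((d + y) ˣ * y ˣ)      ≡⟨ cong (λ n → 2 ^ n * ((d + y) ˣ * y ˣ)) (+-assoc d y y) ⟩
  2 ^ (d + (y + y)) * ((d + y) ˣ * y ˣ)    ≡⟨ cong (_* ((d + y) ˣ * y ˣ)) (^-distribˡ-+-* 2 d (y + y)) ⟩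
  2 ^ d * 2 ^ (y + y) * ((d + y) ˣ * y ˣ)  ≡⟨ rearrange (2 ^ d) (2 ^ (y + y)) ((d + y) ˣ) (y ˣ) ⟩
  2 ^ d * (C * (d + y) ˣ)                  ≤⟨ *-monoʳ-≤ (2 ^ d) (ˣ-lift y C y d C*yˣ≤) ⟩
  2 ^ d * (y + (d + y)) ˣ                  ≡⟨ *-comm (2 ^ d) _ ⟩
  (y + (d + y)) ˣ * 2 ^ d                  ≡⟨ cong (λ n → n ˣ * 2 ^ d) (+-comm y (d + y)) ⟩
  (d + y + y) ˣ * 2 ^ d                    ∎
  where
  open ≤-Reasoning
  C : ℕ
  C = 2 ^ (y + y) * y ˣ
  C*yˣ≤ : C * y ˣ ≤ (y + y) ˣ
  C*yˣ≤ = ≤-reflexive (trans (*-assoc (2 ^ (y + y)) (y ˣ) (y ˣ)) (sym (ˣ-double y)))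
  rearrange : ∀ a b c d → a * b * (c * d) ≡ a * (b * d * c)
  rearrange = solve-∀

pairBound-sorted : ∀ {a b} → b ≤ a → PairBound a b
pairBound-sorted {a} {b} b≤a = subst (λ a → PairBound a b) (m∸n+n≡m b≤a) (shifted (a ∸ b))
  where
  shifted : ∀ d → PairBound (d + b) b
  shifted d rewrite m+n∸n≡m d b | m≤n⇒m∸n≡0 (m≤n+m b d) | +-identityʳ d = ˣ-pair-sorted d b

pairBound-swap : ∀ a b → PairBound a b → PairBound b a
pairBound-swap a b = subst₂ _≤_
  (cong₂ (λ u v → 2 ^ u * v) (+-comm a b) (*-comm (a ˣ) (b ˣ)))
  (cong₂ (λ u v → u ˣ * 2 ^ v) (+-comm a b) (+-comm (a ∸ b) (b ∸ a)))

pairBound : ∀ a b → PairBound a b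
pairBound a b with ≤-total b a
... | inj₁ b≤a = pairBound-sorted b≤a
... | inj₂ a≤b = pairBound-swap b a (pairBound-sorted a≤b)

ˣ-triple-step : ∀ y z → 3 * (suc y ˣ * suc y ˣ) * (z + (y + y)) ˣ ≤ (2 + (z + (y + y))) ˣ * (y ˣ * y ˣ)
ˣ-triple-step y z = *-cancelˡ-≤ Q {{m^n≢0 2 (y + y)}} (begin
  Q * (3 * (Y₁ * Y₁) * W)             ≤⟨ *-monoʳ-≤ Q (*-monoˡ-≤ W (*-monoˡ-≤ (Y₁ * Y₁) (n≤1+n 3))) ⟩
  Q * (4 * (Y₁ * Y₁) * W)             ≡⟨ rearrange Q Y₁ W ⟩
  2 * (2 * Q) * (Y₁ * Y₁) * W         ≡⟨ cong (_* W) (sym [2+y+y]ˣ) ⟩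
  (2 + (y + y)) ˣ * W                 ≤⟨ ˣ-gap-mono 2 (y + y) z ⟩
  (2 + (z + (y + y))) ˣ * (y + y) ˣ   ≡⟨ cong ((2 + (z + (y + y))) ˣ *_) (ˣ-double y) ⟩
  W₂ * (Q * (y ˣ * y ˣ))              ≡⟨ rearrange′ W₂ Q (y ˣ * y ˣ) ⟩
  Q * (W₂ * (y ˣ * y ˣ))              ∎)
  where
  open ≤-Reasoning
  Q Y₁ W W₂ : ℕ
  Q = 2 ^ (y + y)
  Y₁ = suc y ˣ
  W = (z + (y + y)) ˣ
  W₂ = (2 + (z + (y + y))) ˣ
  1+y+1+y : suc y + suc y ≡ 2 + (y + y)
  1+y+1+y = cong suc (+-suc y y)
  [2+y+y]ˣ : (2 + (y + y)) ˣ ≡ 2 * (2 * Q) * (Y₁ * Y₁)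
  [2+y+y]ˣ = trans (cong _ˣ (sym 1+y+1+y))
                   (trans (ˣ-double (suc y)) (cong (λ n → 2 ^ n * (Y₁ * Y₁)) 1+y+1+y))
  rearrange : ∀ Q a W → Q * (4 * (a * a) * W) ≡ 2 * (2 * Q) * (a * a) * W
  rearrange = solve-∀
  rearrange′ : ∀ a b c → a * (b * c) ≡ b * (a * c)
  rearrange′ = solve-∀

ˣ-triple-twoLargestEqual : ∀ e z → let y = e + z in 3 ^ (y + z + z) * (y ˣ * y ˣ * z ˣ) ≤ (z + (y + y)) ˣ
ˣ-triple-twoLargestEqual zero z = ≤-reflexive (trans (sym (ˣ-triple z)) (cong _ˣ (+-assoc z z z)))
ˣ-triple-twoLargestEqual (suc e) z = *-cancelˡ-≤ (y ˣ * y ˣ) {{m*n≢0 _ _ {{ˣ-nonZero y}} {{ˣ-nonZero y}}}} (begin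
  y ˣ * y ˣ * (3 * 3 ^ (y + z + z) * (Y₁ * Y₁ * z ˣ))
    ≡⟨ rearrange (y ˣ) (3 ^ (y + z + z)) Y₁ (z ˣ) ⟩
  3 * (Y₁ * Y₁) * (3 ^ (y + z + z) * (y ˣ * y ˣ * z ˣ))
    ≤⟨ *-monoʳ-≤ (3 * (Y₁ * Y₁)) (ˣ-triple-twoLargestEqual e z) ⟩
  3 * (Y₁ * Y₁) * (z + (y + y)) ˣ
    ≤⟨ ˣ-triple-step y z ⟩
  (2 + (z + (y + y))) ˣ * (y ˣ * y ˣ)
    ≡⟨ cong (λ n → n ˣ * (y ˣ * y ˣ)) (shift z y) ⟩
  (z + (suc y + suc y)) ˣ * (y ˣ * y ˣ)
    ≡⟨ *-comm _ (y ˣ * y ˣ) ⟩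
  y ˣ * y ˣ * (z + (suc y + suc y)) ˣ ∎)
  where
  open ≤-Reasoning
  y Y₁ : ℕ
  y = e + z
  Y₁ = suc y ˣ
  rearrange : ∀ a t b c → a * a * (3 * t * (b * b * c)) ≡ 3 * (b * b) * (t * (a * a * c))
  rearrange = solve-∀
  shift : ∀ z y → 2 + (z + (y + y)) ≡ z + (suc y + suc y)
  shift = solve-∀

ˣ-triple-sorted : ∀ d e z → let y = e + z ; x = d + y in
                  3 ^ (x + y + z) * (x ˣ * y ˣ * z ˣ) ≤ (x + y + z) ˣ * 3 ^ (d + e)
ˣ-triple-sorted d e z = begin
  3 ^ (x + y + z) * (x ˣ * y ˣ * z ˣ)
    ≡⟨ cong (λ n → 3 ^ n * (x ˣ * y ˣ * z ˣ)) (regroup d e z) ⟩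
  3 ^ (d + e + (y + z + z)) * (x ˣ * y ˣ * z ˣ)
    ≡⟨ cong (_* (x ˣ * y ˣ * z ˣ)) (^-distribˡ-+-* 3 (d + e) (y + z + z)) ⟩
  3 ^ (d + e) * 3 ^ (y + z + z) * (x ˣ * y ˣ * z ˣ)
    ≡⟨ rearrange (3 ^ (d + e)) (3 ^ (y + z + z)) (x ˣ) (y ˣ) (z ˣ) ⟩
  3 ^ (d + e) * (C * x ˣ)
    ≤⟨ *-monoʳ-≤ (3 ^ (d + e)) (ˣ-lift (y + z) C y d C*yˣ≤) ⟩
  3 ^ (d + e) * (y + z + x) ˣ
    ≡⟨ *-comm (3 ^ (d + e)) _ ⟩
  (y + z + x) ˣ * 3 ^ (d + e)
    ≡⟨ cong (λ n → n ˣ * 3 ^ (d + e)) (rotate x y z) ⟩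
  (x + y + z) ˣ * 3 ^ (d + e) ∎
  where
  open ≤-Reasoning
  y x C : ℕ
  y = e + z
  x = d + y
  C = 3 ^ (y + z + z) * (y ˣ * z ˣ)
  C*yˣ≤ : C * y ˣ ≤ (y + z + y) ˣ
  C*yˣ≤ = begin
    C * y ˣ                             ≡⟨ rearrange′ (3 ^ (y + z + z)) (y ˣ) (z ˣ) ⟩
    3 ^ (y + z + z) * (y ˣ * y ˣ * z ˣ) ≤⟨ ˣ-triple-twoLargestEqual e z ⟩
    (z + (y + y)) ˣ                     ≡⟨ cong _ˣ (rotate′ z y) ⟩
    (y + z + y) ˣ                       ∎
    where
    rearrange′ : ∀ t a b → t * (a * b) * a ≡ t * (a * a * b)
    rearrange′ = solve-∀
    rotate′ : ∀ z y → z + (y + y) ≡ y + z + y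
    rotate′ = solve-∀
  regroup : ∀ d e z → d + (e + z) + (e + z) + z ≡ d + e + (e + z + z + z)
  regroup = solve-∀
  rearrange : ∀ a t px py pz → a * t * (px * py * pz) ≡ a * (t * (py * pz) * px)
  rearrange = solve-∀
  rotate : ∀ x y z → y + z + x ≡ x + y + z
  rotate = solve-∀

∸-+-swap : ∀ u v → (u ∸ v) + v ≡ (v ∸ u) + u
∸-+-swap zero zero = refl
∸-+-swap zero (suc v) = sym (+-identityʳ (suc v))
∸-+-swap (suc u) zero = +-identityʳ (suc u)
∸-+-swap (suc u) (suc v) = begin
  (u ∸ v) + suc v    ≡⟨ +-suc (u ∸ v) v ⟩
  suc ((u ∸ v) + v)  ≡⟨ cong suc (∸-+-swap u v) ⟩
  suc ((v ∸ u) + u)  ≡⟨ +-suc (v ∸ u) u ⟨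
  (v ∸ u) + suc u    ∎
  where open ≡-Reasoning

TripleBound : ℕ → ℕ → ℕ → Set
TripleBound a b c =
  3 ^ (a + b + c) * (a ˣ * b ˣ * c ˣ) ≤ (a + b + c) ˣ * 3 ^ ((a ∸ b) + (b ∸ c) + (c ∸ a))

tripleBound-sorted : ∀ {a b c} → c ≤ b → b ≤ a → TripleBound a b c
tripleBound-sorted {a} {b} {c} c≤b b≤a =
  subst (λ a → TripleBound a b c) (m∸n+n≡m b≤a)
    (subst (λ y → TripleBound (d + y) y c) (m∸n+n≡m c≤b) (shifted d (b ∸ c)))
  where
  d : ℕ
  d = a ∸ b
  shifted : ∀ d e → TripleBound (d + (e + c)) (e + c) c
  shifted d e rewrite m+n∸n≡m d (e + c) | m+n∸n≡m e c
                    | m≤n⇒m∸n≡0 (≤-trans (m≤n+m c e) (m≤n+m (e + c) d)) | +-identityʳ (d + e)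
    = ˣ-triple-sorted d e c

tripleBound-rotate : ∀ a b c → TripleBound a b c → TripleBound c a b
tripleBound-rotate a b c = subst₂ _≤_
  (cong₂ (λ u v → 3 ^ u * v) (rotate a b c) (*-rotate (a ˣ) (b ˣ) (c ˣ)))
  (cong₂ (λ u v → u ˣ * 3 ^ v) (rotate a b c) (rotate (a ∸ b) (b ∸ c) (c ∸ a)))
  where
  rotate : ∀ a b c → a + b + c ≡ c + a + b
  rotate = solve-∀
  *-rotate : ∀ a b c → a * b * c ≡ c * a * b
  *-rotate = solve-∀

triple-descent-reverse : ∀ a b c → (a ∸ b) + (b ∸ c) + (c ∸ a) ≡ (c ∸ b) + (b ∸ a) + (a ∸ c)
triple-descent-reverse a b c = +-cancelʳ-≡ (a + b + c) _ _ (begin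
  (a ∸ b) + (b ∸ c) + (c ∸ a) + (a + b + c)
    ≡⟨ regroup (a ∸ b) (b ∸ c) (c ∸ a) a b c ⟩
  ((a ∸ b) + b) + ((b ∸ c) + c) + ((c ∸ a) + a)
    ≡⟨ cong₂ _+_ (cong₂ _+_ (∸-+-swap a b) (∸-+-swap b c)) (∸-+-swap c a) ⟩
  ((b ∸ a) + a) + ((c ∸ b) + b) + ((a ∸ c) + c)
    ≡⟨ regroup′ (c ∸ b) (b ∸ a) (a ∸ c) a b c ⟩
  (c ∸ b) + (b ∸ a) + (a ∸ c) + (a + b + c) ∎)
  where
  open ≡-Reasoning
  regroup : ∀ p q r a b c → p + q + r + (a + b + c) ≡ (p + b) + (q + c) + (r + a)
  regroup = solve-∀
  regroup′ : ∀ p q r a b c → (q + a) + (p + b) + (r + c) ≡ p + q + r + (a + b + c)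
  regroup′ = solve-∀

tripleBound-reverse : ∀ a b c → TripleBound a b c → TripleBound c b a
tripleBound-reverse a b c = subst₂ _≤_
  (cong₂ (λ u v → 3 ^ u * v) (reverse a b c) (*-reverse (a ˣ) (b ˣ) (c ˣ)))
  (cong₂ (λ u v → u ˣ * 3 ^ v) (reverse a b c) (triple-descent-reverse a b c))
  where
  reverse : ∀ a b c → a + b + c ≡ c + b + a
  reverse = solve-∀
  *-reverse : ∀ a b c → a * b * c ≡ c * b * a
  *-reverse = solve-∀

tripleBound : ∀ a b c → TripleBound a b c
tripleBound a b c with ≤-total b a | ≤-total c b | ≤-total c a
... | inj₁ b≤a | inj₁ c≤b | _       = tripleBound-sorted c≤b b≤a
... | inj₁ b≤a | inj₂ b≤c | inj₁ c≤a =
  tripleBound-rotate b c a (tripleBound-reverse a c b (tripleBound-sorted b≤c c≤a))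
... | inj₁ b≤a | inj₂ b≤c | inj₂ a≤c =
  tripleBound-rotate b c a (tripleBound-rotate c a b (tripleBound-sorted b≤a a≤c))
... | inj₂ a≤b | inj₁ c≤b | inj₁ c≤a =
  tripleBound-rotate b c a (tripleBound-rotate c a b (tripleBound-reverse b a c (tripleBound-sorted c≤a a≤b)))
... | inj₂ a≤b | inj₁ c≤b | inj₂ a≤c = tripleBound-rotate b c a (tripleBound-sorted a≤c c≤b)
... | inj₂ a≤b | inj₂ b≤c | _       = tripleBound-reverse c b a (tripleBound-sorted a≤b b≤c)

+-∸-subadditive : ∀ u v w t → (u + v) ∸ (w + t) ≤ (u ∸ w) + (v ∸ t)
+-∸-subadditive u v w t = begin
  (u + v) ∸ (w + t)                              ≤⟨ ∸-monoˡ-≤ (w + t) (+-mono-≤ (m≤n+m∸n u w) (m≤n+m∸n v t)) ⟩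
  ((w + (u ∸ w)) + (t + (v ∸ t))) ∸ (w + t)      ≡⟨ cong (_∸ (w + t)) (regroup w (u ∸ w) t (v ∸ t)) ⟩
  ((u ∸ w) + (v ∸ t)) + (w + t) ∸ (w + t)        ≡⟨ m+n∸n≡m _ (w + t) ⟩
  (u ∸ w) + (v ∸ t)                              ∎
  where
  open ≤-Reasoning
  regroup : ∀ w x t y → (w + x) + (t + y) ≡ (x + y) + (w + t)
  regroup = solve-∀

quadruple-descent-reverse : ∀ a b c d →
  (a ∸ b) + (b ∸ c) + (c ∸ d) + (d ∸ a) ≡ (b ∸ a) + (c ∸ b) + (d ∸ c) + (a ∸ d)
quadruple-descent-reverse a b c d = +-cancelʳ-≡ (a + b + c + d) _ _ (begin
  (a ∸ b) + (b ∸ c) + (c ∸ d) + (d ∸ a) + (a + b + c + d)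
    ≡⟨ regroup (a ∸ b) (b ∸ c) (c ∸ d) (d ∸ a) a b c d ⟩
  ((a ∸ b) + b) + ((b ∸ c) + c) + ((c ∸ d) + d) + ((d ∸ a) + a)
    ≡⟨ cong₂ _+_ (cong₂ _+_ (cong₂ _+_ (∸-+-swap a b) (∸-+-swap b c)) (∸-+-swap c d)) (∸-+-swap d a) ⟩
  ((b ∸ a) + a) + ((c ∸ b) + b) + ((d ∸ c) + c) + ((a ∸ d) + d)
    ≡⟨ regroup′ (b ∸ a) (c ∸ b) (d ∸ c) (a ∸ d) a b c d ⟩
  (b ∸ a) + (c ∸ b) + (d ∸ c) + (a ∸ d) + (a + b + c + d) ∎)
  where
  open ≡-Reasoning
  regroup : ∀ p q r s a b c d → p + q + r + s + (a + b + c + d) ≡ (p + b) + (q + c) + (r + d) + (s + a)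
  regroup = solve-∀
  regroup′ : ∀ p q r s a b c d → (p + a) + (q + b) + (r + c) + (s + d) ≡ p + q + r + s + (a + b + c + d)
  regroup′ = solve-∀

pairings≤2*descent : ∀ a b c d →
  ((a ∸ b) + (b ∸ a)) + ((c ∸ d) + (d ∸ c)) + (((a + b) ∸ (c + d)) + ((c + d) ∸ (a + b)))
  ≤ ((a ∸ b) + (b ∸ c) + (c ∸ d) + (d ∸ a)) + ((a ∸ b) + (b ∸ c) + (c ∸ d) + (d ∸ a))
pairings≤2*descent a b c d = begin
  D₁ + D₂ + (((a + b) ∸ (c + d)) + ((c + d) ∸ (a + b)))
    ≡⟨ cong (λ u → D₁ + D₂ + (u ∸ (c + d) + ((c + d) ∸ u))) (+-comm a b) ⟩
  D₁ + D₂ + (((b + a) ∸ (c + d)) + ((c + d) ∸ (b + a)))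
    ≤⟨ +-monoʳ-≤ (D₁ + D₂) (+-mono-≤ (+-∸-subadditive b a c d) (+-∸-subadditive c d b a)) ⟩
  D₁ + D₂ + (((b ∸ c) + (a ∸ d)) + ((c ∸ b) + (d ∸ a)))
    ≡⟨ regroup (a ∸ b) (b ∸ a) (c ∸ d) (d ∸ c) (b ∸ c) (a ∸ d) (c ∸ b) (d ∸ a) ⟩
  V + ((b ∸ a) + (c ∸ b) + (d ∸ c) + (a ∸ d))
    ≡⟨ cong (V +_) (quadruple-descent-reverse a b c d) ⟨
  V + V ∎
  where
  open ≤-Reasoning
  V D₁ D₂ : ℕ
  V = (a ∸ b) + (b ∸ c) + (c ∸ d) + (d ∸ a)
  D₁ = (a ∸ b) + (b ∸ a)
  D₂ = (c ∸ d) + (d ∸ c)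
  regroup : ∀ ab ba cd dc bc ad cb da →
            ab + ba + (cd + dc) + ((bc + ad) + (cb + da)) ≡ (ab + bc + cd + da) + (ba + cb + dc + ad)
  regroup = solve-∀

QuadrupleBound : ℕ → ℕ → ℕ → ℕ → Set
QuadrupleBound a b c d = 4 ^ (a + b + c + d) * (a ˣ * b ˣ * c ˣ * d ˣ)
  ≤ (a + b + c + d) ˣ * 4 ^ ((a ∸ b) + (b ∸ c) + (c ∸ d) + (d ∸ a))

-- Pair a with b and c with d, then a + b with c + d; as 4 = 2², the three pairing costs must fit in twice
-- the cyclic descent.
quadrupleBound : ∀ a b c d → QuadrupleBound a b c d
quadrupleBound a b c d = begin
  4 ^ (a + b + c + d) * (a ˣ * b ˣ * c ˣ * d ˣ)
    ≡⟨ cong (λ u → 4 ^ u * (a ˣ * b ˣ * c ˣ * d ˣ)) S≡ ⟩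
  4 ^ S * (a ˣ * b ˣ * c ˣ * d ˣ)
    ≡⟨ cong (_* (a ˣ * b ˣ * c ˣ * d ˣ)) 4^S≡ ⟩
  X * Y * 2 ^ S * (a ˣ * b ˣ * c ˣ * d ˣ)
    ≡⟨ rearrange X Y (2 ^ S) (a ˣ) (b ˣ) (c ˣ) (d ˣ) ⟩
  2 ^ S * ((X * (a ˣ * b ˣ)) * (Y * (c ˣ * d ˣ)))
    ≤⟨ *-monoʳ-≤ (2 ^ S) (*-mono-≤ (pairBound a b) (pairBound c d)) ⟩
  2 ^ S * (((a + b) ˣ * 2 ^ D₁) * ((c + d) ˣ * 2 ^ D₂))
    ≡⟨ rearrange′ (2 ^ S) ((a + b) ˣ) (2 ^ D₁) ((c + d) ˣ) (2 ^ D₂) ⟩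
  2 ^ S * ((a + b) ˣ * (c + d) ˣ) * (2 ^ D₁ * 2 ^ D₂)
    ≤⟨ *-monoˡ-≤ (2 ^ D₁ * 2 ^ D₂) (pairBound (a + b) (c + d)) ⟩
  S ˣ * 2 ^ D₃ * (2 ^ D₁ * 2 ^ D₂)
    ≡⟨ rearrange″ (S ˣ) (2 ^ D₃) (2 ^ D₁) (2 ^ D₂) ⟩
  S ˣ * (2 ^ D₁ * 2 ^ D₂ * 2 ^ D₃)
    ≡⟨ cong (S ˣ *_) 2^D≡ ⟩
  S ˣ * 2 ^ (D₁ + D₂ + D₃)
    ≤⟨ *-monoʳ-≤ (S ˣ) (^-monoʳ-≤ 2 (pairings≤2*descent a b c d)) ⟩
  S ˣ * 2 ^ (V + V)
    ≡⟨ cong (S ˣ *_) (trans (^-distribˡ-+-* 2 V V) (sym (^-distribʳ-* 2 2 V))) ⟩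
  S ˣ * 4 ^ V
    ≡⟨ cong (λ u → u ˣ * 4 ^ V) S≡ ⟨
  (a + b + c + d) ˣ * 4 ^ V ∎
  where
  open ≤-Reasoning
  S X Y V D₁ D₂ D₃ : ℕ
  S = (a + b) + (c + d)
  X = 2 ^ (a + b)
  Y = 2 ^ (c + d)
  V = (a ∸ b) + (b ∸ c) + (c ∸ d) + (d ∸ a)
  D₁ = (a ∸ b) + (b ∸ a)
  D₂ = (c ∸ d) + (d ∸ c)
  D₃ = ((a + b) ∸ (c + d)) + ((c + d) ∸ (a + b))
  S≡ : a + b + c + d ≡ S
  S≡ = +-assoc (a + b) c d
  4^S≡ : 4 ^ S ≡ X * Y * 2 ^ S
  4^S≡ = trans (^-distribʳ-* 2 2 S) (cong (_* 2 ^ S) (^-distribˡ-+-* 2 (a + b) (c + d)))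
  2^D≡ : 2 ^ D₁ * 2 ^ D₂ * 2 ^ D₃ ≡ 2 ^ (D₁ + D₂ + D₃)
  2^D≡ = sym (trans (^-distribˡ-+-* 2 (D₁ + D₂) D₃) (cong (_* 2 ^ D₃) (^-distribˡ-+-* 2 D₁ D₂)))
  rearrange : ∀ X Y T pa pb pc pd → X * Y * T * (pa * pb * pc * pd) ≡ T * ((X * (pa * pb)) * (Y * (pc * pd)))
  rearrange = solve-∀
  rearrange′ : ∀ T p u q v → T * ((p * u) * (q * v)) ≡ T * (p * q) * (u * v)
  rearrange′ = solve-∀
  rearrange″ : ∀ p x y z → p * x * (y * z) ≡ p * (y * z * x)
  rearrange″ = solve-∀

sumTo : ℕ → (ℕ → ℕ) → ℕ
sumTo zero f = 0
sumTo (suc r) f = f 0 + sumTo r (λ i → f (suc i))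

prodTo : ℕ → (ℕ → ℕ) → ℕ
prodTo zero f = 1
prodTo (suc r) f = f 0 * prodTo r (λ i → f (suc i))

sumTo-cong : ∀ r {f g : ℕ → ℕ} → (∀ i → i < r → f i ≡ g i) → sumTo r f ≡ sumTo r g
sumTo-cong zero f≡g = refl
sumTo-cong (suc r) f≡g = cong₂ _+_ (f≡g 0 z<s) (sumTo-cong r (λ i i<r → f≡g (suc i) (s<s i<r)))

sumTo-mono : ∀ r {f g : ℕ → ℕ} → (∀ i → i < r → f i ≤ g i) → sumTo r f ≤ sumTo r g
sumTo-mono zero f≤g = z≤n
sumTo-mono (suc r) f≤g = +-mono-≤ (f≤g 0 z<s) (sumTo-mono r (λ i i<r → f≤g (suc i) (s<s i<r)))

sumTo-zero : ∀ r → sumTo r (λ _ → 0) ≡ 0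
sumTo-zero zero = refl
sumTo-zero (suc r) = sumTo-zero r

sumTo-distrib-+ : ∀ r (f g : ℕ → ℕ) → sumTo r (λ i → f i + g i) ≡ sumTo r f + sumTo r g
sumTo-distrib-+ zero f g = refl
sumTo-distrib-+ (suc r) f g =
  trans (cong (f 0 + g 0 +_) (sumTo-distrib-+ r (f ∘ suc) (g ∘ suc))) (+-interchange (f 0) (g 0) _ _)

prodTo-mono : ∀ r {f g : ℕ → ℕ} → (∀ i → i < r → f i ≤ g i) → prodTo r f ≤ prodTo r g
prodTo-mono zero f≤g = ≤-refl
prodTo-mono (suc r) f≤g = *-mono-≤ (f≤g 0 z<s) (prodTo-mono r (λ i i<r → f≤g (suc i) (s<s i<r)))

prodTo-distrib-* : ∀ r (f g : ℕ → ℕ) → prodTo r (λ i → f i * g i) ≡ prodTo r f * prodTo r g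
prodTo-distrib-* zero f g = refl
prodTo-distrib-* (suc r) f g =
  trans (cong (f 0 * g 0 *_) (prodTo-distrib-* r (f ∘ suc) (g ∘ suc))) (*-interchange (f 0) (g 0) _ _)

^-distribˡ-sumTo : ∀ x r (f : ℕ → ℕ) → x ^ sumTo r f ≡ prodTo r (λ i → x ^ f i)
^-distribˡ-sumTo x zero f = refl
^-distribˡ-sumTo x (suc r) f =
  trans (^-distribˡ-+-* x (f 0) _) (cong (x ^ f 0 *_) (^-distribˡ-sumTo x r (f ∘ suc)))

-- Only the drops p i > p (i + 1) around the cycle count: ∸ truncates the rises to 0.
descent : (r : ℕ) .{{_ : NonZero r}} → (ℕ → ℕ) → ℕ
descent r p = sumTo r (λ i → p i ∸ p (suc i % r))

-- This is the only place where exp G ≤ 4 enters.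
cyclic-ˣ-bound : ∀ r .{{_ : NonZero r}} → r ≤ 4 → ∀ p →
                 r ^ sumTo r p * prodTo r (λ i → p i ˣ) ≤ sumTo r p ˣ * r ^ descent r p
cyclic-ˣ-bound 1 _ p
  rewrite ^-zeroˡ (p 0 + 0) | ^-zeroˡ ((p 0 ∸ p 0) + 0) | +-identityʳ (p 0) | *-identityʳ (p 0 ˣ)
  = ≤-reflexive (+-identityʳ (p 0 ˣ))
cyclic-ˣ-bound 2 _ p
  rewrite +-identityʳ (p 1) | *-identityʳ (p 1 ˣ) | +-identityʳ (p 1 ∸ p 0)
  = pairBound (p 0) (p 1)
cyclic-ˣ-bound 3 _ p = subst₂ _≤_
  (cong₂ (λ u v → 3 ^ u * v) (assocʳ a b c) (*-assocʳ (a ˣ) (b ˣ) (c ˣ)))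
  (cong₂ (λ u v → u ˣ * 3 ^ v) (assocʳ a b c) (assocʳ (a ∸ b) (b ∸ c) (c ∸ a)))
  (tripleBound a b c)
  where
  a b c : ℕ
  a = p 0
  b = p 1
  c = p 2
  assocʳ : ∀ a b c → a + b + c ≡ a + (b + (c + 0))
  assocʳ = solve-∀
  *-assocʳ : ∀ a b c → a * b * c ≡ a * (b * (c * 1))
  *-assocʳ = solve-∀
cyclic-ˣ-bound 4 _ p = subst₂ _≤_
  (cong₂ (λ u v → 4 ^ u * v) (assocʳ a b c d) (*-assocʳ (a ˣ) (b ˣ) (c ˣ) (d ˣ)))
  (cong₂ (λ u v → u ˣ * 4 ^ v) (assocʳ a b c d) (assocʳ (a ∸ b) (b ∸ c) (c ∸ d) (d ∸ a)))
  (quadrupleBound a b c d)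
  where
  a b c d : ℕ
  a = p 0
  b = p 1
  c = p 2
  d = p 3
  assocʳ : ∀ a b c d → a + b + c + d ≡ a + (b + (c + (d + 0)))
  assocʳ = solve-∀
  *-assocʳ : ∀ a b c d → a * b * c * d ≡ a * (b * (c * (d * 1)))
  *-assocʳ = solve-∀
cyclic-ˣ-bound (suc (suc (suc (suc (suc _))))) (s≤s (s≤s (s≤s (s≤s ()))))

cycle-bound : ∀ {M} .{{_ : NonZero M}} → M ≤ 4 → ∀ r .{{_ : NonZero r}} → r ≤ M →
              ∀ N (p b : ℕ → ℕ) e → descent r p ≤ e → (∀ i → i < r → N ^ p i ≤ p i ˣ * M ^ b i) →
              (r * N) ^ sumTo r p ≤ sumTo r p ˣ * M ^ (e + sumTo r b)
cycle-bound {M} M≤4 r r≤M N p b e descent≤e bounds = begin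
  (r * N) ^ o
    ≡⟨ ^-distribʳ-* r N o ⟩
  r ^ o * N ^ o
    ≡⟨ cong (r ^ o *_) (^-distribˡ-sumTo N r p) ⟩
  r ^ o * prodTo r (λ i → N ^ p i)
    ≤⟨ *-monoʳ-≤ (r ^ o) (prodTo-mono r bounds) ⟩
  r ^ o * prodTo r (λ i → p i ˣ * M ^ b i)
    ≡⟨ cong (r ^ o *_) (prodTo-distrib-* r (λ i → p i ˣ) (λ i → M ^ b i)) ⟩
  r ^ o * (Π * prodTo r (λ i → M ^ b i))
    ≡⟨ cong (λ u → r ^ o * (Π * u)) (^-distribˡ-sumTo M r b) ⟨
  r ^ o * (Π * M ^ B)
    ≡⟨ *-assoc (r ^ o) Π (M ^ B) ⟨
  r ^ o * Π * M ^ B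
    ≤⟨ *-monoˡ-≤ (M ^ B) (cyclic-ˣ-bound r (≤-trans r≤M M≤4) p) ⟩
  o ˣ * r ^ descent r p * M ^ B
    ≤⟨ *-monoˡ-≤ (M ^ B) (*-monoʳ-≤ (o ˣ) r^descent≤M^e) ⟩
  o ˣ * M ^ e * M ^ B
    ≡⟨ *-assoc (o ˣ) (M ^ e) (M ^ B) ⟩
  o ˣ * (M ^ e * M ^ B)
    ≡⟨ cong (o ˣ *_) (^-distribˡ-+-* M e B) ⟨
  o ˣ * M ^ (e + B) ∎
  where
  open ≤-Reasoning
  o B Π : ℕ
  o = sumTo r p
  B = sumTo r b
  Π = prodTo r (λ i → p i ˣ)
  r^descent≤M^e : r ^ descent r p ≤ M ^ e
  r^descent≤M^e = ≤-trans (^-monoˡ-≤ (descent r p) r≤M) (^-monoʳ-≤ M descent≤e)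

ˣ-bound-+ : ∀ M N o ρ b c → N ^ o ≤ o ˣ * M ^ b → N ^ ρ ≤ ρ ˣ * M ^ c →
            N ^ (o + ρ) ≤ (o + ρ) ˣ * M ^ (b + c)
ˣ-bound-+ M N o ρ b c o-bound ρ-bound = begin
  N ^ (o + ρ)
    ≡⟨ ^-distribˡ-+-* N o ρ ⟩
  N ^ o * N ^ ρ
    ≤⟨ *-mono-≤ o-bound ρ-bound ⟩
  o ˣ * M ^ b * (ρ ˣ * M ^ c)
    ≡⟨ *-interchange (o ˣ) (M ^ b) (ρ ˣ) (M ^ c) ⟩
  o ˣ * ρ ˣ * (M ^ b * M ^ c)
    ≤⟨ *-monoˡ-≤ (M ^ b * M ^ c) (*-mono-≤ (^-monoˡ-≤ o (m≤m+n o ρ)) (^-monoˡ-≤ ρ (m≤n+m ρ o))) ⟩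
  (o + ρ) ^ o * (o + ρ) ^ ρ * (M ^ b * M ^ c)
    ≡⟨ cong₂ _*_ (^-distribˡ-+-* (o + ρ) o ρ) (^-distribˡ-+-* M b c) ⟨
  (o + ρ) ˣ * M ^ (b + c) ∎
  where open ≤-Reasoning

^-cancelʳ-≤ : ∀ {x y} n .{{_ : NonZero n}} → x ^ n ≤ y ^ n → x ≤ y
^-cancelʳ-≤ {x} {y} n xⁿ≤yⁿ with x ≤? y
... | yes x≤y = x≤y
... | no x≰y = contradiction xⁿ≤yⁿ (<⇒≱ (^-monoˡ-< n (≰⇒> x≰y)))

power-root-bound : ∀ m n a p q B .{{_ : NonZero m}} .{{_ : NonZero a}} → p ≤ q →
                   (m ^ n) ^ a ≤ a ˣ * m ^ B → B * q ≤ (q ∸ p) * n * a → (m ^ n) ^ p ≤ a ^ q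
power-root-bound m n a p q B p≤q gᵃ≤ Bq≤ =
  ^-cancelʳ-≤ a (subst₂ _≤_ (^-swap g p a) (^-swap a q a)
    (*-cancelʳ-≤ (g ^ (a * p)) (a ^ (a * q)) (g ^ (k * a)) {{m^n≢0 g (k * a) {{m^n≢0 m n}}}} gᵃᵖ*gᵏᵃ≤))
  where
  open ≤-Reasoning
  g k : ℕ
  g = m ^ n
  k = q ∸ p
  ^-swap : ∀ x u v → x ^ (v * u) ≡ (x ^ u) ^ v
  ^-swap x u v = trans (cong (x ^_) (*-comm v u)) (sym (^-*-assoc x u v))
  gᵃᵖ*gᵏᵃ≤ : g ^ (a * p) * g ^ (k * a) ≤ a ^ (a * q) * g ^ (k * a)
  gᵃᵖ*gᵏᵃ≤ = begin
    g ^ (a * p) * g ^ (k * a)      ≡⟨ ^-distribˡ-+-* g (a * p) (k * a) ⟨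
    g ^ (a * p + k * a)            ≡⟨ cong (g ^_) (collect a p k) ⟩
    g ^ (a * (p + k))              ≡⟨ cong (λ u → g ^ (a * u)) (m+[n∸m]≡n p≤q) ⟩
    g ^ (a * q)                    ≡⟨ ^-*-assoc g a q ⟨
    (g ^ a) ^ q                    ≤⟨ ^-monoˡ-≤ q gᵃ≤ ⟩
    (a ˣ * m ^ B) ^ q              ≡⟨ ^-distribʳ-* (a ˣ) (m ^ B) q ⟩
    (a ˣ) ^ q * (m ^ B) ^ q        ≡⟨ cong₂ _*_ (^-*-assoc a a q) (^-*-assoc m B q) ⟩
    a ^ (a * q) * m ^ (B * q)      ≤⟨ *-monoʳ-≤ (a ^ (a * q)) (^-monoʳ-≤ m Bq≤) ⟩
    a ^ (a * q) * m ^ (k * n * a)  ≡⟨ cong (λ u → a ^ (a * q) * m ^ u) (regroup k n a) ⟩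
    a ^ (a * q) * m ^ (n * (k * a)) ≡⟨ cong (a ^ (a * q) *_) (^-*-assoc m n (k * a)) ⟨
    a ^ (a * q) * g ^ (k * a)      ∎
    where
    collect : ∀ a p k → a * p + k * a ≡ a * (p + k)
    collect = solve-∀
    regroup : ∀ k n a → k * n * a ≡ n * (k * a)
    regroup = solve-∀

[m%d+n]%d≡[m+n]%d : ∀ m n d .{{_ : NonZero d}} → (m % d + n) % d ≡ (m + n) % d
[m%d+n]%d≡[m+n]%d m n d = begin
  (m % d + n) % d            ≡⟨ %-distribˡ-+ (m % d) n d ⟩
  (m % d % d + n % d) % d    ≡⟨ cong (λ u → (u + n % d) % d) (m%n%n≡m%n m d) ⟩
  (m % d + n % d) % d        ≡⟨ %-distribˡ-+ m n d ⟨
  (m + n) % d                ∎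
  where open ≡-Reasoning

[m+n%d]%d≡[m+n]%d : ∀ m n d .{{_ : NonZero d}} → (m + n % d) % d ≡ (m + n) % d
[m+n%d]%d≡[m+n]%d m n d = begin
  (m + n % d) % d  ≡⟨ cong (_% d) (+-comm m (n % d)) ⟩
  (n % d + m) % d  ≡⟨ [m%d+n]%d≡[m+n]%d n m d ⟩
  (n + m) % d      ≡⟨ cong (_% d) (+-comm n m) ⟩
  (m + n) % d      ∎
  where open ≡-Reasoning

sumOver : {A : Set} → List A → (A → ℕ) → ℕ
sumOver L f = sum (map f L)

syntax sumOver L (λ x → e) = ∑[ x ∈ L ] e

sumOver-cong : {A : Set} (L : List A) {f g : A → ℕ} → (∀ {x} → x ∈ L → f x ≡ g x) →
               sumOver L f ≡ sumOver L g
sumOver-cong L f≡g = cong sum (map-cong-local (tabulate f≡g))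

sumOver-distrib-+ : {A : Set} (L : List A) (f g : A → ℕ) → ∑[ x ∈ L ] (f x + g x) ≡ sumOver L f + sumOver L g
sumOver-distrib-+ [] f g = refl
sumOver-distrib-+ (x ∷ L) f g =
  trans (cong (f x + g x +_) (sumOver-distrib-+ L f g)) (+-interchange (f x) (g x) _ _)

sumOver-const-1 : {A : Set} (L : List A) → ∑[ x ∈ L ] 1 ≡ length L
sumOver-const-1 [] = refl
sumOver-const-1 (x ∷ L) = cong suc (sumOver-const-1 L)

sumOver-indicator : ∀ {A : Set} {p} {P : Pred A p} (P? : Decidable P) (L : List A) →
                    ∑[ x ∈ L ] (if does (P? x) then 0 else 1) + length (filter P? L) ≡ length L
sumOver-indicator P? [] = refl
sumOver-indicator P? (x ∷ L) with does (P? x)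
... | true = trans (+-suc _ _) (cong suc (sumOver-indicator P? L))
... | false = cong suc (sumOver-indicator P? L)

Unique-⊆⇒length≤ : {A : Set} {L L′ : List A} → Unique L → (∀ {x} → x ∈ L → x ∈ L′) →
                   length L ≤ length L′
Unique-⊆⇒length≤ {L = []} _ _ = z≤n
Unique-⊆⇒length≤ {L = x ∷ L} {L′} (x∉L ∷ uniq) L⊆L′
  with ys , zs , refl ← ∈-∃++ (L⊆L′ (here refl)) = begin
  suc (length L)                ≤⟨ s≤s (Unique-⊆⇒length≤ uniq L⊆ys++zs) ⟩
  suc (length (ys ++ zs))       ≡⟨ cong suc (length-++ ys) ⟩
  suc (length ys + length zs)   ≡⟨ +-suc (length ys) (length zs) ⟨
  length ys + length (x ∷ zs)   ≡⟨ length-++ ys ⟨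
  length (ys ++ x ∷ zs)         ∎
  where
  open ≤-Reasoning
  L⊆ys++zs : ∀ {y} → y ∈ L → y ∈ ys ++ zs
  L⊆ys++zs {y} y∈L with ∈-++⁻ ys (L⊆L′ (there y∈L))
  ... | inj₁ y∈ys = ∈-++⁺ˡ y∈ys
  ... | inj₂ (here refl) = contradiction y∈L (All¬⇒¬Any x∉L)
  ... | inj₂ (there y∈zs) = ∈-++⁺ʳ ys y∈zs

classOf : {A : Set} → (A → ℕ) → ℕ → List A → List A
classOf c i = filter (λ x → c x ≟ i)

spike : ℕ → ℕ → ℕ → ℕ
spike j v i = if j ≡ᵇ i then v else 0

sumTo-spike : ∀ r j v → j < r → sumTo r (spike j v) ≡ v
sumTo-spike (suc r) zero v _ = trans (cong (v +_) (sumTo-zero r)) (+-identityʳ v)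
sumTo-spike (suc r) (suc j) v (s<s j<r) = sumTo-spike r j v j<r

sumOver-classOf-∷ : {A : Set} (c : A → ℕ) (f : A → ℕ) (i : ℕ) (x : A) (L : List A) →
                    sumOver (classOf c i (x ∷ L)) f ≡ spike (c x) (f x) i + sumOver (classOf c i L) f
sumOver-classOf-∷ c f i x L with c x ≡ᵇ i
... | true = refl
... | false = refl

sumOver-partition : {A : Set} (c : A → ℕ) (r : ℕ) (f : A → ℕ) (L : List A) →
                    (∀ {x} → x ∈ L → c x < r) → sumOver L f ≡ sumTo r (λ i → sumOver (classOf c i L) f)
sumOver-partition c r f [] _ = sym (sumTo-zero r)
sumOver-partition c r f (x ∷ L) c<r = begin
  f x + sumOver L f
    ≡⟨ cong (f x +_) (sumOver-partition c r f L (c<r ∘ there)) ⟩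
  f x + sumTo r (λ i → sumOver (classOf c i L) f)
    ≡⟨ cong (_+ _) (sumTo-spike r (c x) (f x) (c<r (here refl))) ⟨
  sumTo r (spike (c x) (f x)) + sumTo r (λ i → sumOver (classOf c i L) f)
    ≡⟨ sumTo-distrib-+ r _ _ ⟨
  sumTo r (λ i → spike (c x) (f x) i + sumOver (classOf c i L) f)
    ≡⟨ sumTo-cong r (λ i _ → sumOver-classOf-∷ c f i x L) ⟨
  sumTo r (λ i → sumOver (classOf c i (x ∷ L)) f) ∎
  where open ≡-Reasoning

length-partition : {A : Set} (c : A → ℕ) (r : ℕ) (L : List A) → (∀ {x} → x ∈ L → c x < r) →
                   length L ≡ sumTo r (λ i → length (classOf c i L))
length-partition c r L c<r = begin
  length L                                      ≡⟨ sumOver-const-1 L ⟨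
  ∑[ x ∈ L ] 1                                  ≡⟨ sumOver-partition c r (λ _ → 1) L c<r ⟩
  sumTo r (λ i → ∑[ x ∈ classOf c i L ] 1)      ≡⟨ sumTo-cong r (λ i _ → sumOver-const-1 (classOf c i L)) ⟩
  sumTo r (λ i → length (classOf c i L))        ∎
  where open ≡-Reasoning

∈-classOf⁻ : {A : Set} (c : A → ℕ) (L : List A) {i : ℕ} {x : A} → x ∈ classOf c i L → x ∈ L × c x ≡ i
∈-classOf⁻ c L {i} = ∈-filter⁻ (λ x → c x ≟ i)

∈-classOf⁺ : {A : Set} (c : A → ℕ) (L : List A) {i : ℕ} {x : A} → x ∈ L → c x ≡ i → x ∈ classOf c i L
∈-classOf⁺ c L {i} = ∈-filter⁺ (λ x → c x ≟ i)

classOf-Unique : {A : Set} (c : A → ℕ) (i : ℕ) {L : List A} → Unique L → Unique (classOf c i L)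
classOf-Unique c i = Unique.filter⁺ (λ x → c x ≟ i)

leastBelow : ∀ {p} {P : Pred ℕ p} → ℕ → Decidable P → ℕ
leastBelow zero P? = 0
leastBelow (suc k) P? = if does (P? 0) then 0 else suc (leastBelow k (P? ∘ suc))

leastBelow-≤ : ∀ {p} {P : Pred ℕ p} k (P? : Decidable P) → leastBelow k P? ≤ k
leastBelow-≤ zero P? = z≤n
leastBelow-≤ (suc k) P? with P? 0
... | yes _ = z≤n
... | no _ = s≤s (leastBelow-≤ k (P? ∘ suc))

leastBelow-satisfies : ∀ {p} {P : Pred ℕ p} k (P? : Decidable P) → leastBelow k P? < k → P (leastBelow k P?)
leastBelow-satisfies (suc k) P? found with P? 0
... | yes P0 = P0
... | no _ = leastBelow-satisfies k (P? ∘ suc) (s<s⁻¹ found)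

leastBelow-minimal : ∀ {p} {P : Pred ℕ p} k (P? : Decidable P) {i} → i < leastBelow k P? → ¬ P i
leastBelow-minimal (suc k) P? {i} i< with P? 0
leastBelow-minimal (suc k) P? {zero} _ | no ¬P0 = ¬P0
leastBelow-minimal (suc k) P? {suc i} i< | no _ = leastBelow-minimal k (P? ∘ suc) (s<s⁻¹ i<)

leastBelow-≤-witness : ∀ {p} {P : Pred ℕ p} k (P? : Decidable P) {i} → P i → leastBelow k P? ≤ i
leastBelow-≤-witness k P? {i} Pi with leastBelow k P? ≤? i
... | yes ≤i = ≤i
... | no ≰i = contradiction Pi (leastBelow-minimal k P? (≰⇒> ≰i))

module CayleyGraph {X : Set} (_≟_ : DecidableEquality X) {op : Op₂ X} {ε : X}
                      (isCommutativeMonoid : IsCommutativeMonoid _≡_ op ε) where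

  commutativeMonoid : CommutativeMonoid 0ℓ 0ℓ
  commutativeMonoid = record
    { Carrier = X ; _≈_ = _≡_ ; _∙_ = op ; ε = ε ; isCommutativeMonoid = isCommutativeMonoid }

  open CommutativeMonoid commutativeMonoid using (_∙_; assoc; comm; identityˡ; identityʳ; isMonoid)
  open import Algebra.Properties.CommutativeMonoid.Mult commutativeMonoid
    using (×-homo-+; ×-assocˡ) renaming (_×_ to _·_) public
  open import Algebra.Properties.CommutativeSemigroup (CommutativeMonoid.commutativeSemigroup commutativeMonoid)
    using (interchange; xy∙z≈xz∙y)
  open DecMembership _≟_ using (_∈?_)

  out : List X → X → ℕ
  out L x = if does (x ∈? L) then 0 else 1

  out-cong : ∀ {L L′ x} → (x ∈ L → x ∈ L′) → (x ∈ L′ → x ∈ L) → out L x ≡ out L′ x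
  out-cong {L} {L′} {x} L⊆L′ L′⊆L with x ∈? L | x ∈? L′
  ... | yes _ | yes _ = refl
  ... | no _ | no _ = refl
  ... | yes x∈L | no x∉L′ = contradiction (L⊆L′ x∈L) x∉L′
  ... | no x∉L | yes x∈L′ = contradiction (L′⊆L x∈L′) x∉L

  ∂ : List X → List X → ℕ
  ∂ S L = ∑[ a ∈ L ] ∑[ s ∈ S ] out L (a ∙ s)

  exits : X → List X → ℕ
  exits s L = ∑[ a ∈ L ] out L (a ∙ s)

  ∂-∷ : ∀ s S L → ∂ (s ∷ S) L ≡ exits s L + ∂ S L
  ∂-∷ s S L = sumOver-distrib-+ L (λ a → out L (a ∙ s)) (λ a → ∑[ t ∈ S ] out L (a ∙ t))

  ∂-partition : ∀ (c : X → ℕ) r S L → (∀ {x} → x ∈ L → c x < r) →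
                (∀ {x t} → x ∈ L → t ∈ S → x ∙ t ∈ L → c (x ∙ t) ≡ c x) →
                ∂ S L ≡ sumTo r (λ i → ∂ S (classOf c i L))
  ∂-partition c r S L c<r c-invariant =
    trans (sumOver-partition c r _ L c<r)
          (sumTo-cong r (λ i _ → sumOver-cong (classOf c i L) (λ a∈ → sumOver-cong S (out-classOf a∈))))
    where
    out-classOf : ∀ {i a t} → a ∈ classOf c i L → t ∈ S → out L (a ∙ t) ≡ out (classOf c i L) (a ∙ t)
    out-classOf a∈ t∈S with a∈L , refl ← ∈-classOf⁻ c L a∈ =
      out-cong (λ a∙t∈L → ∈-classOf⁺ c L a∙t∈L (c-invariant a∈L t∈S a∙t∈L))
               (proj₁ ∘ ∈-classOf⁻ c L)

  Span : List X → X → Set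
  Span [] z = z ≡ ε
  Span (s ∷ S) z = ∃₂ λ k y → Span S y × k · s ∙ y ≡ z

  span-ε : ∀ S → Span S ε
  span-ε [] = refl
  span-ε (s ∷ S) = 0 , ε , span-ε S , identityˡ ε

  span-∙ : ∀ S {y z} → Span S y → Span S z → Span S (y ∙ z)
  span-∙ [] refl refl = identityˡ ε
  span-∙ (s ∷ S) (j , y , span-y , refl) (k , z , span-z , refl) =
    j + k , y ∙ z , span-∙ S span-y span-z ,
    trans (cong (_∙ (y ∙ z)) (×-homo-+ s j k)) (interchange (j · s) (k · s) y z)

  span-· : ∀ S k {y} → Span S y → Span S (k · y)
  span-· S zero _ = span-ε S
  span-· S (suc k) span-y = span-∙ S span-y (span-· S k span-y)

  span-generator : ∀ {S t} → t ∈ S → Span S t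
  span-generator {s ∷ S} (here refl) = 1 , ε , span-ε S , trans (identityʳ (s ∙ ε)) (identityʳ s)
  span-generator {s ∷ S} {t} (there t∈S) = 0 , t , span-generator t∈S , identityˡ t

  shifts : ℕ → X → List X → List X
  shifts zero s L = []
  shifts (suc k) s L = map (λ y → k · s ∙ y) L ++ shifts k s L

  shifts-∈⁺ : ∀ {k s L j y} → j < k → y ∈ L → j · s ∙ y ∈ shifts k s L
  shifts-∈⁺ {suc k} {s} {L} j<1+k y∈L with m<1+n⇒m<n∨m≡n j<1+k
  ... | inj₁ j<k = ∈-++⁺ʳ _ (shifts-∈⁺ {k} j<k y∈L)
  ... | inj₂ refl = ∈-++⁺ˡ (∈-map⁺ (λ y → k · s ∙ y) y∈L)

  shifts-∈⁻ : ∀ {k s L z} → z ∈ shifts k s L → ∃₂ λ j y → y ∈ L × j · s ∙ y ≡ z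
  shifts-∈⁻ {suc k} {s} {L} z∈ with ∈-++⁻ (map (λ y → k · s ∙ y) L) z∈
  ... | inj₁ z∈map with y , y∈L , refl ← ∈-map⁻ (λ y → k · s ∙ y) z∈map = k , y , y∈L , refl
  ... | inj₂ z∈shifts = shifts-∈⁻ {k} z∈shifts

  length-shifts : ∀ k s L → length (shifts k s L) ≡ k * length L
  length-shifts zero s L = refl
  length-shifts (suc k) s L = begin
    length (map (λ y → k · s ∙ y) L ++ shifts k s L)
      ≡⟨ length-++ (map (λ y → k · s ∙ y) L) ⟩
    length (map (λ y → k · s ∙ y) L) + length (shifts k s L)
      ≡⟨ cong₂ _+_ (length-map _ L) (length-shifts k s L) ⟩
    length L + k * length L ∎
    where open ≡-Reasoning

  module Exponent (M₀ : ℕ) (exponent : ∀ x → suc M₀ · x ≡ ε) where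

    M : ℕ
    M = suc M₀

    group : Group 0ℓ 0ℓ
    group = record
      { Carrier = X ; _≈_ = _≡_ ; _∙_ = _∙_ ; ε = ε ; _⁻¹ = M₀ ·_
      ; isGroup = record
        { isMonoid = isMonoid
        ; inverse = (λ x → trans (comm (M₀ · x) x) (exponent x)) , exponent
        ; ⁻¹-cong = cong (M₀ ·_)
        }
      }

    open Group group using (_⁻¹; _\\_; _//_)
    open import Algebra.Properties.Group group using (quasigroup; \\-leftDividesˡ; //-rightDividesʳ)
    open import Algebra.Properties.Quasigroup quasigroup using (cancelˡ; cancelʳ; y≈x\\z)

    ·-mod : ∀ r .{{_ : NonZero r}} k x → k · x ≡ (k % r) · x ∙ (k / r) · (r · x)
    ·-mod r k x = begin
      k · x                                ≡⟨ cong (_· x) (m≡m%n+[m/n]*n k r) ⟩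
      (k % r + k / r * r) · x              ≡⟨ ×-homo-+ x (k % r) (k / r * r) ⟩
      (k % r) · x ∙ (k / r * r) · x        ≡⟨ cong ((k % r) · x ∙_) (×-assocˡ x (k / r) r) ⟨
      (k % r) · x ∙ (k / r) · (r · x)      ∎
      where open ≡-Reasoning

    -- relOrder s S is the order of s modulo ⟨S⟩, found by search in 1 … M since M · s = ε; enumerate
    -- lists ⟨s ∷ S⟩ coset by coset, so length (enumerate S) is the product of the relative orders.
    mutual
      enumerate : List X → List X
      enumerate [] = [ ε ]
      enumerate (s ∷ S) = shifts (relOrder s S) s (enumerate S)

      relOrder : X → List X → ℕ
      relOrder s S = suc (leastBelow M₀ (λ i → suc i · s ∈? enumerate S))

    enumerate-sound : ∀ S {z} → z ∈ enumerate S → Span S z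
    enumerate-sound [] (here refl) = refl
    enumerate-sound (s ∷ S) z∈ with j , y , y∈ , j·s∙y≡z ← shifts-∈⁻ {relOrder s S} z∈ =
      j , y , enumerate-sound S y∈ , j·s∙y≡z

    relOrder≤M : ∀ s S → relOrder s S ≤ M
    relOrder≤M s S = s≤s (leastBelow-≤ M₀ _)

    relOrder-spans : ∀ s S → Span S (relOrder s S · s)
    relOrder-spans s S with m≤n⇒m<n∨m≡n (leastBelow-≤ M₀ (λ i → suc i · s ∈? enumerate S))
    ... | inj₁ found = enumerate-sound S (leastBelow-satisfies M₀ _ found)
    ... | inj₂ none = subst (Span S) (sym (trans (cong (λ i → suc i · s) none) (exponent s))) (span-ε S)

    enumerate-complete : ∀ S {z} → Span S z → z ∈ enumerate S
    enumerate-complete [] refl = here refl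
    enumerate-complete (s ∷ S) (k , y , span-y , refl) =
      subst (_∈ enumerate (s ∷ S)) (sym k·s∙y≡) (shifts-∈⁺ {r} (m%n<n k r) (enumerate-complete S span-rest))
      where
      r : ℕ
      r = relOrder s S
      span-rest : Span S ((k / r) · (r · s) ∙ y)
      span-rest = span-∙ S (span-· S (k / r) (relOrder-spans s S)) span-y
      k·s∙y≡ : k · s ∙ y ≡ (k % r) · s ∙ ((k / r) · (r · s) ∙ y)
      k·s∙y≡ = trans (cong (_∙ y) (·-mod r k s)) (assoc _ _ y)

    relOrder-minimal : ∀ s S {t} → 0 < t → t < relOrder s S → ¬ Span S (t · s)
    relOrder-minimal s S {suc i} _ (s<s i<) span =
      leastBelow-minimal M₀ (λ i → suc i · s ∈? enumerate S) i< (enumerate-complete S span)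

    span? : ∀ S z → Dec (Span S z)
    span? S z with z ∈? enumerate S
    ... | yes z∈ = yes (enumerate-sound S z∈)
    ... | no z∉ = no (z∉ ∘ enumerate-complete S)

    _∼[_]_ : X → List X → X → Set
    x ∼[ S ] y = ∃ λ k → Span S k × x ∙ k ≡ y

    _∼[_]?_ : ∀ x S y → Dec (x ∼[ S ] y)
    x ∼[ S ]? y with span? S (x \\ y)
    ... | yes span = yes (x \\ y , span , \\-leftDividesˡ x y)
    ... | no ¬span = no λ { (k , span-k , refl) → ¬span (subst (Span S) (y≈x\\z x k _ refl) span-k) }

    ∼-refl : ∀ S x → x ∼[ S ] x
    ∼-refl S x = ε , span-ε S , identityʳ x

    ∼-trans : ∀ S {x y z} → x ∼[ S ] y → y ∼[ S ] z → x ∼[ S ] z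
    ∼-trans S {x} (k , span-k , refl) (l , span-l , refl) = k ∙ l , span-∙ S span-k span-l , sym (assoc x k l)

    ∼-sym : ∀ S {x y} → x ∼[ S ] y → y ∼[ S ] x
    ∼-sym S {x} (k , span-k , refl) = k ⁻¹ , span-· S M₀ span-k , //-rightDividesʳ k x

    ∼-step : ∀ S {x y t} → Span S t → x ∼[ S ] y → x ∼[ S ] (y ∙ t)
    ∼-step S {x} {t = t} span-t (k , span-k , refl) = k ∙ t , span-∙ S span-k span-t , sym (assoc x k t)

    ∼-unstep : ∀ S {x y t} → Span S t → x ∼[ S ] (y ∙ t) → x ∼[ S ] y
    ∼-unstep S {y = y} {t} span-t x∼y∙t =
      subst (_ ∼[ S ]_) (//-rightDividesʳ t y) (∼-step S (span-· S M₀ span-t) x∼y∙t)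

    ∼-shift : ∀ S {x y} t → x ∼[ S ] y → (x ∙ t) ∼[ S ] (y ∙ t)
    ∼-shift S {x} t (k , span-k , refl) = k , span-k , xy∙z≈xz∙y x t k

    -- Within the coset a₀ ∙ ⟨s ∷ S⟩ the cosets of ⟨S⟩ are the levels a₀ ∙ i · s ∙ ⟨S⟩, i < relOrder s S,
    -- and adding s moves level i to level i + 1 modulo relOrder s S.
    module Cycle (s : X) (S : List X) (a₀ : X) where

      r : ℕ
      r = relOrder s S

      OnLevel : ℕ → X → Set
      OnLevel i x = (a₀ ∙ i · s) ∼[ S ] x

      onLevel? : ∀ x → Decidable (λ i → OnLevel i x)
      onLevel? x i = (a₀ ∙ i · s) ∼[ S ]? x

      level : X → ℕ
      level x = leastBelow r (onLevel? x)

      onSomeLevel : ∀ {x} → a₀ ∼[ s ∷ S ] x → ∃ λ i → i < r × OnLevel i x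
      onSomeLevel {x} (_ , (t , y , span-y , refl) , a₀∙t·s∙y≡x) =
        t % r , m%n<n t r , w ∙ y , span-∙ S (span-· S (t / r) (relOrder-spans s S)) span-y , a₀∙∙≡x
        where
        open ≡-Reasoning
        w : X
        w = (t / r) · (r · s)
        a₀∙∙≡x : a₀ ∙ (t % r) · s ∙ (w ∙ y) ≡ x
        a₀∙∙≡x = begin
          a₀ ∙ (t % r) · s ∙ (w ∙ y)    ≡⟨ assoc a₀ _ (w ∙ y) ⟩
          a₀ ∙ ((t % r) · s ∙ (w ∙ y))  ≡⟨ cong (a₀ ∙_) (assoc _ w y) ⟨
          a₀ ∙ ((t % r) · s ∙ w ∙ y)    ≡⟨ cong (λ u → a₀ ∙ (u ∙ y)) (·-mod r t s) ⟨
          a₀ ∙ (t · s ∙ y)              ≡⟨ a₀∙t·s∙y≡x ⟩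
          x                             ∎

      levels-disjoint : ∀ {i j x} → i < j → j < r → OnLevel i x → OnLevel j x → ⊥
      levels-disjoint {i} {j} i<j j<r onᵢ onⱼ
        with k , span-k , a₀∙i·s∙k≡ ← ∼-trans S onᵢ (∼-sym S onⱼ) =
        relOrder-minimal s S (m<n⇒0<n∸m i<j) (≤-<-trans (m∸n≤m j i) j<r) (subst (Span S) k≡ span-k)
        where
        open ≡-Reasoning
        k≡ : k ≡ (j ∸ i) · s
        k≡ = cancelˡ (a₀ ∙ i · s) k _ (begin
          a₀ ∙ i · s ∙ k                ≡⟨ a₀∙i·s∙k≡ ⟩
          a₀ ∙ j · s                    ≡⟨ cong (λ u → a₀ ∙ u · s) (m+[n∸m]≡n (<⇒≤ i<j)) ⟨
          a₀ ∙ (i + (j ∸ i)) · s        ≡⟨ cong (a₀ ∙_) (×-homo-+ s i (j ∸ i)) ⟩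
          a₀ ∙ (i · s ∙ (j ∸ i) · s)    ≡⟨ assoc a₀ _ _ ⟨
          a₀ ∙ i · s ∙ (j ∸ i) · s      ∎)

      level-unique : ∀ {i x} → i < r → OnLevel i x → level x ≡ i
      level-unique {i} {x} i<r onᵢ with m≤n⇒m<n∨m≡n (leastBelow-≤-witness r (onLevel? x) onᵢ)
      ... | inj₂ level≡i = level≡i
      ... | inj₁ level<i = ⊥-elim (levels-disjoint level<i i<r
                                     (leastBelow-satisfies r (onLevel? x) (<-trans level<i i<r)) onᵢ)

      level-spec : ∀ {x} → a₀ ∼[ s ∷ S ] x → level x < r × OnLevel (level x) x
      level-spec a₀∼x with i , i<r , onᵢ ← onSomeLevel a₀∼x rewrite level-unique i<r onᵢ = i<r , onᵢ

      level-∙-generator : ∀ {x t} → a₀ ∼[ s ∷ S ] x → t ∈ S → level (x ∙ t) ≡ level x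
      level-∙-generator a₀∼x t∈S with level<r , on ← level-spec a₀∼x =
        level-unique level<r (∼-step S (span-generator t∈S) on)

      onLevel-∙-s : ∀ {i x} → OnLevel i x → OnLevel (suc i) (x ∙ s)
      onLevel-∙-s {i} {x} onᵢ =
        subst (_∼[ S ] (x ∙ s)) (trans (assoc a₀ (i · s) s) (cong (a₀ ∙_) (comm (i · s) s))) (∼-shift S s onᵢ)

      onLevel-r⇒0 : ∀ {x} → OnLevel r x → OnLevel 0 x
      onLevel-r⇒0 = ∼-trans S (r · s , relOrder-spans s S , cong (_∙ r · s) (identityʳ a₀))

      level-∙-s : ∀ {x} → a₀ ∼[ s ∷ S ] x → level (x ∙ s) ≡ suc (level x) % r
      level-∙-s {x} a₀∼x with level<r , on ← level-spec a₀∼x with m<1+n⇒m<n∨m≡n (s<s level<r)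
      ... | inj₁ 1+level<r =
        trans (level-unique 1+level<r (onLevel-∙-s {level x} on)) (sym (m<n⇒m%n≡m 1+level<r))
      ... | inj₂ 1+level≡r =
        trans (level-unique z<s (onLevel-r⇒0 (subst (λ i → OnLevel i (x ∙ s)) 1+level≡r (onLevel-∙-s {level x} on))))
              (sym (trans (cong (_% r) 1+level≡r) (n%n≡0 r)))

    length∸length≤exits : ∀ s L {P P′} → Unique P → (∀ {a} → a ∈ P → a ∙ s ∈ L → a ∙ s ∈ P′) →
                          length P ∸ length P′ ≤ ∑[ a ∈ P ] out L (a ∙ s)
    length∸length≤exits s L {P} {P′} uniq step = begin
      length P ∸ length P′                       ≤⟨ ∸-monoʳ-≤ (length P) |stay|≤|P′| ⟩
      length P ∸ length stay                     ≡⟨ cong (_∸ length stay) (sumOver-indicator stays? P) ⟨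
      ∑[ a ∈ P ] out L (a ∙ s) + length stay ∸ length stay ≡⟨ m+n∸n≡m _ (length stay) ⟩
      ∑[ a ∈ P ] out L (a ∙ s)                   ∎
      where
      open ≤-Reasoning
      stays? : Decidable (λ a → a ∙ s ∈ L)
      stays? = λ a → (a ∙ s) ∈? L
      stay : List X
      stay = filter stays? P
      stay∙s⊆P′ : ∀ {b} → b ∈ map (_∙ s) stay → b ∈ P′
      stay∙s⊆P′ b∈ with a , a∈stay , refl ← ∈-map⁻ (_∙ s) b∈ =
        uncurry step (∈-filter⁻ stays? a∈stay)
      |stay|≤|P′| : length stay ≤ length P′
      |stay|≤|P′| = subst (_≤ length P′) (length-map (_∙ s) stay)
        (Unique-⊆⇒length≤ (Unique.map⁺ (cancelʳ s _ _) (Unique.filter⁺ stays? uniq)) stay∙s⊆P′)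

    module CosetSplit (H : List X) (a₀ : X) where

      side : X → ℕ
      side x = if does (a₀ ∼[ H ]? x) then 0 else 1

      side<2 : ∀ x → side x < 2
      side<2 x with a₀ ∼[ H ]? x
      ... | yes _ = z<s
      ... | no _ = s<s z<s

      side-∙-generator : ∀ {x t} → t ∈ H → side (x ∙ t) ≡ side x
      side-∙-generator {x} {t} t∈H with a₀ ∼[ H ]? x | a₀ ∼[ H ]? (x ∙ t)
      ... | yes _ | yes _ = refl
      ... | no _ | no _ = refl
      ... | yes a₀∼x | no a₀≁x∙t = contradiction (∼-step H (span-generator t∈H) a₀∼x) a₀≁x∙t
      ... | no a₀≁x | yes a₀∼x∙t = contradiction (∼-unstep H (span-generator t∈H) a₀∼x∙t) a₀≁x

      side≡0⇒∼ : ∀ {x} → side x ≡ 0 → a₀ ∼[ H ] x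
      side≡0⇒∼ {x} with a₀ ∼[ H ]? x
      ... | yes a₀∼x = λ _ → a₀∼x
      ... | no _ = λ ()

      side-a₀ : side a₀ ≡ 0
      side-a₀ with a₀ ∼[ H ]? a₀
      ... | yes _ = refl
      ... | no a₀≁a₀ = contradiction (∼-refl H a₀) a₀≁a₀

    EdgeBound : List X → List X → Set
    EdgeBound S L = length (enumerate S) ^ length L ≤ length L ˣ * M ^ ∂ S L

    module _ (M≤4 : M ≤ 4) where

      coset-edgeBound : ∀ s S → (∀ {L} → Unique L → EdgeBound S L) →
                        ∀ a₀ {O} → Unique O → (∀ {x} → x ∈ O → a₀ ∼[ s ∷ S ] x) → EdgeBound (s ∷ S) O
      coset-edgeBound s S edgeBound-S a₀ {O} uniq inCoset =
        subst₂ (λ u v → length (enumerate (s ∷ S)) ^ u ≤ u ˣ * M ^ v) (sym |O|≡) (sym ∂O≡) bound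
        where
        open Cycle s S a₀
        p b : ℕ → ℕ
        p i = length (classOf level i O)
        b i = ∂ S (classOf level i O)
        level<r : ∀ {x} → x ∈ O → level x < r
        level<r = proj₁ ∘ level-spec ∘ inCoset
        |O|≡ : length O ≡ sumTo r p
        |O|≡ = length-partition level r O level<r
        ∂O≡ : ∂ (s ∷ S) O ≡ exits s O + sumTo r b
        ∂O≡ = trans (∂-∷ s S O) (cong (exits s O +_)
                (∂-partition level r S O level<r (λ x∈O t∈S _ → level-∙-generator (inCoset x∈O) t∈S)))
        next : ∀ i {a} → a ∈ classOf level i O → a ∙ s ∈ O → a ∙ s ∈ classOf level (suc i % r) O
        next i a∈ a∙s∈O with a∈O , refl ← ∈-classOf⁻ level O a∈ =
          ∈-classOf⁺ level O a∙s∈O (level-∙-s (inCoset a∈O))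
        descent≤exits : descent r p ≤ exits s O
        descent≤exits = begin
          descent r p
            ≤⟨ sumTo-mono r (λ i _ → length∸length≤exits s O (classOf-Unique level i uniq) (next i)) ⟩
          sumTo r (λ i → ∑[ a ∈ classOf level i O ] out O (a ∙ s))
            ≡⟨ sumOver-partition level r _ O level<r ⟨
          exits s O ∎
          where open ≤-Reasoning
        bound : length (enumerate (s ∷ S)) ^ sumTo r p ≤ sumTo r p ˣ * M ^ (exits s O + sumTo r b)
        bound rewrite length-shifts r s (enumerate S) =
          cycle-bound M≤4 r (relOrder≤M s S) (length (enumerate S)) p b (exits s O) descent≤exits
                      (λ i _ → edgeBound-S (classOf-Unique level i uniq))

      edgeBound-∷ : ∀ s S → (∀ {L} → Unique L → EdgeBound S L) →
                    ∀ n {L} → length L ≤ n → Unique L → EdgeBound (s ∷ S) L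
      edgeBound-∷ s S edgeBound-S n {[]} _ _ = ≤-refl
      edgeBound-∷ s S edgeBound-S (suc n) {L@(a₀ ∷ _)} |L|≤ uniq =
        subst₂ (λ u v → N ^ u ≤ u ˣ * M ^ v) (sym |L|≡) (sym ∂L≡)
          (ˣ-bound-+ M N (length O) (length R) (∂ H O) (∂ H R) O-bound R-bound)
        where
        H : List X
        H = s ∷ S
        N : ℕ
        N = length (enumerate H)
        open CosetSplit H a₀
        O R : List X
        O = classOf side 0 L
        R = classOf side 1 L
        |L|≡ : length L ≡ length O + length R
        |L|≡ = trans (length-partition side 2 L (λ {x} _ → side<2 x)) (cong (length O +_) (+-identityʳ (length R)))
        ∂L≡ : ∂ H L ≡ ∂ H O + ∂ H R
        ∂L≡ = trans (∂-partition side 2 H L (λ {x} _ → side<2 x) (λ _ t∈H _ → side-∙-generator t∈H))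
                    (cong (∂ H O +_) (+-identityʳ (∂ H R)))
        |R|≤n : length R ≤ n
        |R|≤n = s≤s⁻¹ (begin
          suc (length R)        ≤⟨ +-monoˡ-≤ (length R) (∈-length (∈-classOf⁺ side L (here refl) side-a₀)) ⟩
          length O + length R   ≡⟨ |L|≡ ⟨
          length L              ≤⟨ |L|≤ ⟩
          suc n                 ∎)
          where open ≤-Reasoning
        O-bound : EdgeBound H O
        O-bound = coset-edgeBound s S edgeBound-S a₀ (classOf-Unique side 0 uniq)
                                  (side≡0⇒∼ ∘ proj₂ ∘ ∈-classOf⁻ side L)
        R-bound : EdgeBound H R
        R-bound = edgeBound-∷ s S edgeBound-S n |R|≤n (classOf-Unique side 1 uniq)

      edgeBound : ∀ S {L} → Unique L → EdgeBound S L
      edgeBound [] {L} _ rewrite ^-zeroˡ (length L) =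
        >-nonZero⁻¹ _ {{m*n≢0 _ _ {{ˣ-nonZero (length L)}} {{m^n≢0 M (∂ [] L)}}}}
      edgeBound (s ∷ S) {L} = edgeBound-∷ s S (edgeBound S) (length L) ≤-refl

      size-edgeBound : ∀ S {G L} → Unique G → (∀ g → Span S g) → Unique L →
                       length G ^ length L ≤ length L ˣ * M ^ ∂ S L
      size-edgeBound S {L = L} uniq-G spanning uniq-L = ≤-trans
        (^-monoˡ-≤ (length L) (Unique-⊆⇒length≤ uniq-G (λ {g} _ → enumerate-complete S (spanning g))))
        (edgeBound S uniq-L)

length-cartesianProductWith : ∀ {A B C : Set} (f : A → B → C) (xs : List A) (ys : List B) →
                              length (cartesianProductWith f xs ys) ≡ length xs * length ys
length-cartesianProductWith f [] ys = refl
length-cartesianProductWith f (x ∷ xs) ys = begin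
  length (map (f x) ys ++ cartesianProductWith f xs ys)
    ≡⟨ length-++ (map (f x) ys) ⟩
  length (map (f x) ys) + length (cartesianProductWith f xs ys)
    ≡⟨ cong₂ _+_ (length-map (f x) ys) (length-cartesianProductWith f xs ys) ⟩
  length ys + length xs * length ys ∎
  where open ≡-Reasoning

module Homocyclic (m₀ : ℕ) where

  m : ℕ
  m = suc m₀

  toℕ-+ₘ : ∀ (a b : Fin m) → toℕ (a +ₘ b) ≡ (toℕ a + toℕ b) % m
  toℕ-+ₘ a b = toℕ-fromℕ< _

  +ₘ-assoc : ∀ (a b c : Fin m) → (a +ₘ b) +ₘ c ≡ a +ₘ (b +ₘ c)
  +ₘ-assoc a b c = toℕ-injective (begin
    toℕ ((a +ₘ b) +ₘ c)                    ≡⟨ toℕ-+ₘ (a +ₘ b) c ⟩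
    (toℕ (a +ₘ b) + toℕ c) % m             ≡⟨ cong (λ u → (u + toℕ c) % m) (toℕ-+ₘ a b) ⟩
    ((toℕ a + toℕ b) % m + toℕ c) % m      ≡⟨ [m%d+n]%d≡[m+n]%d (toℕ a + toℕ b) (toℕ c) m ⟩
    (toℕ a + toℕ b + toℕ c) % m            ≡⟨ cong (_% m) (+-assoc (toℕ a) (toℕ b) (toℕ c)) ⟩
    (toℕ a + (toℕ b + toℕ c)) % m          ≡⟨ [m+n%d]%d≡[m+n]%d (toℕ a) (toℕ b + toℕ c) m ⟨
    (toℕ a + (toℕ b + toℕ c) % m) % m      ≡⟨ cong (λ u → (toℕ a + u) % m) (toℕ-+ₘ b c) ⟨
    (toℕ a + toℕ (b +ₘ c)) % m             ≡⟨ toℕ-+ₘ a (b +ₘ c) ⟨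
    toℕ (a +ₘ (b +ₘ c))                    ∎)
    where open ≡-Reasoning

  +ₘ-comm : ∀ (a b : Fin m) → a +ₘ b ≡ b +ₘ a
  +ₘ-comm a b = toℕ-injective (begin
    toℕ (a +ₘ b)            ≡⟨ toℕ-+ₘ a b ⟩
    (toℕ a + toℕ b) % m     ≡⟨ cong (_% m) (+-comm (toℕ a) (toℕ b)) ⟩
    (toℕ b + toℕ a) % m     ≡⟨ toℕ-+ₘ b a ⟨
    toℕ (b +ₘ a)            ∎)
    where open ≡-Reasoning

  +ₘ-identityˡ : ∀ (a : Fin m) → zeroₘ +ₘ a ≡ a
  +ₘ-identityˡ a = toℕ-injective (trans (toℕ-+ₘ zeroₘ a) (m<n⇒m%n≡m (toℕ<n a)))

  ⊕-isCommutativeMonoid : ∀ n → IsCommutativeMonoid _≡_ (_⊕_ {m} {n}) 𝟎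
  ⊕-isCommutativeMonoid n = isCommutativeMonoidˡ record
    { isSemigroup = record { isMagma = isMagma _⊕_ ; assoc = zipWith-assoc +ₘ-assoc }
    ; identityˡ = zipWith-identityˡ +ₘ-identityˡ
    ; comm = zipWith-comm +ₘ-comm
    }

  _·ᶠ_ : ℕ → Fin m → Fin m
  zero ·ᶠ a = zeroₘ
  suc k ·ᶠ a = a +ₘ (k ·ᶠ a)

  toℕ-·ᶠ : ∀ k a → toℕ (k ·ᶠ a) ≡ (k * toℕ a) % m
  toℕ-·ᶠ zero a = refl
  toℕ-·ᶠ (suc k) a = begin
    toℕ (a +ₘ (k ·ᶠ a))               ≡⟨ toℕ-+ₘ a (k ·ᶠ a) ⟩
    (toℕ a + toℕ (k ·ᶠ a)) % m        ≡⟨ cong (λ u → (toℕ a + u) % m) (toℕ-·ᶠ k a) ⟩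
    (toℕ a + (k * toℕ a) % m) % m     ≡⟨ [m+n%d]%d≡[m+n]%d (toℕ a) (k * toℕ a) m ⟩
    (toℕ a + k * toℕ a) % m           ∎
    where open ≡-Reasoning

  m·ᶠa≡0 : ∀ a → m ·ᶠ a ≡ zeroₘ
  m·ᶠa≡0 a = toℕ-injective (begin
    toℕ (m ·ᶠ a)        ≡⟨ toℕ-·ᶠ m a ⟩
    (m * toℕ a) % m     ≡⟨ cong (_% m) (*-comm m (toℕ a)) ⟩
    (toℕ a * m) % m     ≡⟨ m*n%n≡0 (toℕ a) m ⟩
    0                   ∎)
    where open ≡-Reasoning

  module Vectors (n : ℕ) = CayleyGraph (≡-dec {n = n} (_≟F_ {m})) (⊕-isCommutativeMonoid n)

  ·-∷ : ∀ {n} k a (x : Grp m n) → Vectors._·_ (suc n) k (a ∷ x) ≡ (k ·ᶠ a) ∷ Vectors._·_ n k x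
  ·-∷ zero a x = refl
  ·-∷ {n} (suc k) a x = cong ((a ∷ x) ⊕_) (·-∷ k a x)

  exponent : ∀ n (x : Grp m n) → Vectors._·_ n m x ≡ 𝟎
  exponent zero [] with Vectors._·_ zero m []
  ... | [] = refl
  exponent (suc n) (a ∷ x) = trans (·-∷ m a x) (cong₂ _∷_ (m·ᶠa≡0 a) (exponent n x))

  allVectors : ∀ n → List (Grp m n)
  allVectors zero = [ [] ]
  allVectors (suc n) = cartesianProductWith _∷_ (allFin m) (allVectors n)

  length-allVectors : ∀ n → length (allVectors n) ≡ m ^ n
  length-allVectors zero = refl
  length-allVectors (suc n) = begin
    length (cartesianProductWith _∷_ (allFin m) (allVectors n))
      ≡⟨ length-cartesianProductWith _∷_ (allFin m) (allVectors n) ⟩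
    length (allFin m) * length (allVectors n)
      ≡⟨ cong₂ _*_ (length-tabulate {n = m} (λ i → i)) (length-allVectors n) ⟩
    m * m ^ n ∎
    where open ≡-Reasoning

  allVectors-Unique : ∀ n → Unique (allVectors n)
  allVectors-Unique zero = [] ∷ []
  allVectors-Unique (suc n) = Unique.cartesianProductWith⁺ _∷_ ∷-injective (Unique.allFin⁺ m) (allVectors-Unique n)

  module _ (m≤4 : m ≤ 4) (n : ℕ) where

    open Vectors n
    open Exponent m₀ (exponent n)
    open DecMembership (≡-dec {n = n} (_≟F_ {m})) using (_∈?_)

    generated⇒span : ∀ {S g} → Generated S g → Span S g
    generated⇒span {S} gen-zero = span-ε S
    generated⇒span (gen-elem g∈S) = span-generator g∈S
    generated⇒span {S} (gen-add gen-x gen-y) = span-∙ S (generated⇒span gen-x) (generated⇒span gen-y)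

    -- The indicator used by boundary is local to its where-block and cannot be named here, so the
    -- left-hand side is left to unification with its use in boundary≡∂ below.
    indicator≡out : ∀ (S A : List (Grp m n)) a s → _ ≡ out A (a ⊕ s)

    boundary≡∂ : ∀ S A → boundary S A ≡ ∂ S A
    boundary≡∂ S A = cong sum (map-cong (λ a → cong sum (map-cong (indicator≡out S A a) S)) A)

    indicator≡out S A a s with (a ⊕ s) ∈? A
    ... | yes _ = refl
    ... | no _ = refl

    homocyclic-edgeBound : ∀ {A S : List (Grp m n)} → Unique A → Generates S →
                           (m ^ n) ^ length A ≤ length A ˣ * m ^ boundary S A
    homocyclic-edgeBound {A} {S} uniq-A generates =
      subst₂ (λ G B → G ^ length A ≤ length A ˣ * m ^ B) (length-allVectors n) (sym (boundary≡∂ S A))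
        (size-edgeBound m≤4 S (allVectors-Unique n) (generated⇒span ∘ generates) uniq-A)

theorem1p1 : (m n : ℕ) .{{_ : NonZero m}} → (m ≡ 2 ⊎ m ≡ 3 ⊎ m ≡ 4) → 1 ≤ n →
    (A S : List (Grp m n)) → Unique A → Unique S → 1 ≤ length A → Generates S →
    (p q : ℕ) → 0 < p → p ≤ q →
    boundary S A * q ≤ (q ∸ p) * n * length A →
    (m ^ n) ^ p ≤ length A ^ q
theorem1p1 (suc m₀) n m∈234 _ A S uniq-A _ 1≤|A| generates p q _ p≤q ∂q≤ =
  power-root-bound (suc m₀) n (length A) p q (boundary S A) {{_}} {{>-nonZero 1≤|A|}} p≤q
    (Homocyclic.homocyclic-edgeBound m₀ (m∈234⇒m≤4 m∈234) n uniq-A generates) ∂q≤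
  where
  m∈234⇒m≤4 : suc m₀ ≡ 2 ⊎ suc m₀ ≡ 3 ⊎ suc m₀ ≡ 4 → suc m₀ ≤ 4
  m∈234⇒m≤4 (inj₁ refl) = s≤s (s≤s z≤n)
  m∈234⇒m≤4 (inj₂ (inj₁ refl)) = s≤s (s≤s (s≤s z≤n))
  m∈234⇒m≤4 (inj₂ (inj₂ refl)) = s≤s (s≤s (s≤s (s≤s z≤n)))
theorem1p1 zero n (inj₁ ())
theorem1p1 zero n (inj₂ (inj₁ ()))
theorem1p1 zero n (inj₂ (inj₂ ()))
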